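{- For any rule $R$ for a description mode and any $Z\in 2^{\omega}$, there exists an $R$-optimal mode relative to $Z$.
   Context: $2^{<\omega}$ is the set of finite binary strings, $|\tau|$ the length of $\tau$, and $\sigma^\frown\tau$ concatenation. A rule for a description mode is a recursive set $R$ of finite subsets of $2^{<\omega}\times 2^{<\omega}$ such that: $\emptyset\in R$; if $r\in R$ and $s\subseteq r$ then $s\in R$; if $r,s\in R$ then $\{(0^\frown\tau,\sigma):(\tau,\sigma)\in r\}\cup\{(1^\frown\tau,\sigma):(\tau,\sigma)\in s\}\in R$. A mode relative to $Z$ is a $Z$-r.e. set $M\subseteq 2^{<\omega}\times 2^{<\omega}$, with complexity $K^M(\sigma)=\min\{|\tau|:(\tau,\sigma)\in M\}$. A mode $M$ (relative to $Z$) is an $R$-mode if every finite subset of $M$ belongs to $R$; an $R$-mode $M$ relative to $Z$ is $R$-optimal if for every $R$-mode $M'$ relative to $Z$ there is $c\in\omega$ with $K^M(\sigma)\le K^{M'}(\sigma)+c$ for all $\sigma$. -}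

module Defs where

open import Data.Nat using (ℕ; zero; suc; _+_; _≤_; _≟_)
open import Data.Bool using (Bool; true; false; if_then_else_)
open import Data.List using (List; []; _∷_; map; _++_; length)
open import Data.List.Membership.Propositional using (_∈_)
open import Data.List.Relation.Unary.All using (All)
open import Data.Maybe using (Maybe; just; nothing)
open import Data.Product using (_×_; _,_; Σ; ∃; ∃-syntax)
open import Relation.Nullary using (yes; no)
open import Relation.Binary.PropositionalEquality using (_≡_)

Oracle : Set
Oracle = ℕ → Bool

-- A Turing-complete model of computation relative to an oracle:
-- register machines (unboundedly many ℕ-valued registers) with an
-- oracle-query instruction.

data Instr : Set where
  inc : ℕ → Instr
  dec : ℕ → ℕ → Instr
  orc : ℕ → Instr

Program : Set
Program = List Instr

Regs : Set
Regs = ℕ → ℕ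

set : Regs → ℕ → ℕ → Regs
set ρ r v k with k ≟ r
... | yes _ = v
... | no _  = ρ k

nth : Program → ℕ → Maybe Instr
nth []      _       = nothing
nth (i ∷ _) zero    = just i
nth (_ ∷ p) (suc n) = nth p n

bit : Bool → ℕ
bit true  = 1
bit false = 0

step : Oracle → Instr → ℕ → Regs → ℕ × Regs
step Z (inc r)   pc ρ = suc pc , set ρ r (suc (ρ r))
step Z (dec r j) pc ρ with ρ r
... | zero  = j , ρ
... | suc v = suc pc , set ρ r v
step Z (orc r)   pc ρ = suc pc , set ρ r (bit (Z (ρ r)))

-- run with a fuel bound; the machine halts when the program counter
-- does not point at an instruction.  'nothing' = not halted within fuel.
run : Program → Oracle → (fuel : ℕ) → (pc : ℕ) → Regs → Maybe Regs
run P Z fuel pc ρ with nth P pc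
... | nothing = just ρ
run P Z zero    pc ρ | just i = nothing
run P Z (suc f) pc ρ | just i with step Z i pc ρ
... | pc' , ρ' = run P Z f pc' ρ'

input : ℕ → Regs
input x zero    = x
input x (suc _) = 0

Halts : Program → Oracle → ℕ → Set
Halts P Z x = ∃[ fuel ] ∃[ ρ ] (run P Z fuel 0 (input x) ≡ just ρ)

HaltsWith : Program → Oracle → ℕ → ℕ → Set
HaltsWith P Z x y = ∃[ fuel ] ∃[ ρ ] ((run P Z fuel 0 (input x) ≡ just ρ) × (ρ 0 ≡ y))

∅ₒ : Oracle
∅ₒ _ = false

tri : ℕ → ℕ
tri zero    = zero
tri (suc n) = suc n + tri n

pair : ℕ → ℕ → ℕ
pair a b = tri (a + b) + b

Str : Set
Str = List Bool

codeStr : Str → ℕ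
codeStr []      = 0
codeStr (b ∷ s) = suc (pair (bit b) (codeStr s))

-- elements (τ , σ) of 2^{<ω} × 2^{<ω}: τ a description, σ the described string
Pair : Set
Pair = Str × Str

codePair : Pair → ℕ
codePair (τ , σ) = pair (codeStr τ) (codeStr σ)

-- finite subsets of 2^{<ω} × 2^{<ω}, presented by (any) listing of their elements
codeList : List Pair → ℕ
codeList []      = 0
codeList (x ∷ l) = suc (pair (codePair x) (codeList l))

-- a set of finite subsets of 2^{<ω} × 2^{<ω} (finite subsets given as lists;
-- by subset-closure below, membership only depends on the set of elements)
FinSetFamily : Set₁
FinSetFamily = List Pair → Set

_⊆ₗ_ : List Pair → List Pair → Set
s ⊆ₗ r = ∀ {x} → x ∈ s → x ∈ r

Recursive : FinSetFamily → Set
Recursive R = Σ Program λ P → ∀ l → ∃[ y ] (HaltsWith P ∅ₒ (codeList l) y × ((R l → y ≡ 1) × (y ≡ 1 → R l)))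

prefix : Bool → List Pair → List Pair
prefix b = map (λ { (τ , σ) → (b ∷ τ , σ) })

join : List Pair → List Pair → List Pair
join r s = prefix false r ++ prefix true s

record IsRule (R : FinSetFamily) : Set where
  field
    recursive : Recursive R
    empty     : R []
    downward  : ∀ r s → R r → s ⊆ₗ r → R s
    joinClosed : ∀ r s → R r → R s → R (join r s)

Mode : Set₁
Mode = Pair → Set

REin : Oracle → Mode → Set
REin Z M = Σ Program λ P → ∀ x → (M x → Halts P Z (codePair x)) × (Halts P Z (codePair x) → M x)

IsRMode : FinSetFamily → Mode → Set
IsRMode R M = ∀ (l : List Pair) → All M l → R l

-- "K^M(σ) ≤ n", where K^M(σ) = min{|τ| : (τ,σ) ∈ M}  (= ∞ if no such τ)
K≤ : Mode → Str → ℕ → Set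
K≤ M σ n = ∃[ τ ] (M (τ , σ) × length τ ≤ n)

-- K^M(σ) ≤ K^{M'}(σ) + c for all σ (with the convention ∞ + c = ∞)
Dominates : Mode → Mode → ℕ → Set
Dominates M M' c = ∀ σ n → K≤ M' σ n → K≤ M σ (n + c)

IsROptimal : FinSetFamily → Oracle → Mode → Set₁
IsROptimal R Z M =
  REin Z M × IsRMode R M ×
  (∀ (M' : Mode) → REin Z M' → IsRMode R M' → ∃[ c ] Dominates M M' c)

module Submission where

open import Defs
open import Data.Nat using (ℕ; zero; suc; _+_; _≤_; _<_; _∸_; z≤n; s≤s; _≟_; _<?_; _≤?_; pred; ∣_-_∣)
open import Data.Nat.Properties
open import Data.Nat.Induction using (<-wellFounded)
open import Induction.WellFounded using (Acc; acc)
open import Data.Bool using (Bool; true; false)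
import Data.Bool as Bool
open import Data.Unit using (⊤; tt)
open import Data.Fin using (Fin; #_)
open import Data.Vec using (Vec; []; _∷_; lookup) renaming (map to vmap)
open import Data.Vec.Properties using (lookup-map)
open import Data.Vec.Relation.Unary.All using (All; []; _∷_) renaming (map to All-map)
open import Data.Vec.Relation.Unary.All.Properties using (lookup⁺)
open import Data.List using (List; []; _∷_; _++_; length; map; drop; head; replicate)
open import Data.List.Properties using (length-++; length-replicate; drop-drop)
open import Data.List.Membership.Propositional using (_∈_)
open import Data.List.Membership.Propositional.Properties using (∈-map⁺; ∈-map⁻; ∈-++⁺ˡ; ∈-++⁺ʳ)
open import Data.List.Relation.Unary.Any using (here; there)
import Data.List.Relation.Unary.All as ListAll
open import Data.Maybe using (Maybe; just; nothing)
open import Data.Maybe.Properties using (just-injective)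
open import Data.Product using (_×_; _,_; Σ; ∃; ∃-syntax; proj₁; proj₂)
open import Data.Sum using (_⊎_; inj₁; inj₂)
open import Data.Empty using (⊥-elim)
open import Relation.Binary.PropositionalEquality
open import Relation.Nullary using (yes; no)
open import Relation.Nullary.Decidable using (from-yes; True; toWitness)

-- The optimal mode consists of the pairs (1^e 0 τ, σ) such that, at some stage s, the e-th machine
-- with oracle Z has enumerated (τ, σ) and the finite set A(e, s) it has enumerated by then is
-- accepted by the decision procedure for R.  If e is a program for a Z-r.e. R-mode M', every
-- A(e, s) is a finite subset of M', hence in R, so the optimal mode describes σ by 1^e 0 τ whenever
-- M' describes it by τ.  Conversely a finite subset of the optimal mode is in R by induction on
-- description length: its pairs below 1^k 0 all come from machine k, so they lie in a single
-- A(k, s) ∈ R, and those below 1^k 1 are handled by the induction hypothesis; join and downward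
-- closure put the two halves together.  To see that the mode is Z-r.e., register machines are
-- simulated by primitive recursion with oracle, primitive recursive functions are compiled back
-- into register machines, and one machine searches for a witness (e, τ, σ, s, t).

module Execution where

  data Steps (P : Program) (Z : Oracle) : ℕ → ℕ → Regs → ℕ → Regs → Set where
    done : ∀ {pc ρ} → Steps P Z 0 pc ρ pc ρ
    more : ∀ {k pc ρ i pc' ρ' pc'' ρ''} → nth P pc ≡ just i → step Z i pc ρ ≡ (pc' , ρ') →
           Steps P Z k pc' ρ' pc'' ρ'' → Steps P Z (suc k) pc ρ pc'' ρ''

  Steps-++ : ∀ {P Z k l pc ρ pc' ρ' pc'' ρ''} → Steps P Z k pc ρ pc' ρ' → Steps P Z l pc' ρ' pc'' ρ'' →
             Steps P Z (k + l) pc ρ pc'' ρ''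
  Steps-++ done t = t
  Steps-++ (more e1 e2 s) t = more e1 e2 (Steps-++ s t)

  run-step : ∀ P Z f pc ρ i → nth P pc ≡ just i →
             run P Z (suc f) pc ρ ≡ run P Z f (proj₁ (step Z i pc ρ)) (proj₂ (step Z i pc ρ))
  run-step P Z f pc ρ i e with nth P pc
  run-step P Z f pc ρ i refl | just .i with step Z i pc ρ
  ... | _ = refl

  run-out-of-fuel : ∀ P Z pc ρ i → nth P pc ≡ just i → run P Z 0 pc ρ ≡ nothing
  run-out-of-fuel P Z pc ρ i e with nth P pc
  run-out-of-fuel P Z pc ρ i refl | just .i = refl

  run-halted : ∀ P Z f pc ρ → nth P pc ≡ nothing → run P Z f pc ρ ≡ just ρ
  run-halted P Z f pc ρ e with nth P pc
  run-halted P Z zero    pc ρ refl | nothing = refl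
  run-halted P Z (suc f) pc ρ refl | nothing = refl

  run-Steps⁺ : ∀ {P Z k pc ρ pc' ρ'} → Steps P Z k pc ρ pc' ρ' →
               ∀ f a → run P Z f pc' ρ' ≡ just a → run P Z (k + f) pc ρ ≡ just a
  run-Steps⁺ done f a e = e
  run-Steps⁺ {P} {Z} {suc k} {pc} {ρ} (more {i = i} e1 e2 s) f a e
    rewrite run-step P Z (k + f) pc ρ i e1 | e2 = run-Steps⁺ s f a e

  run-Steps⁻ : ∀ {P Z k pc ρ pc' ρ'} → Steps P Z k pc ρ pc' ρ' →
               ∀ f a → run P Z f pc ρ ≡ just a → ∃[ f' ] (f ≡ k + f' × run P Z f' pc' ρ' ≡ just a)
  run-Steps⁻ done f a e = f , refl , e
  run-Steps⁻ {P} {Z} {pc = pc} {ρ} (more {i = i} e1 e2 s) zero a e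
    with () ← trans (sym (run-out-of-fuel P Z pc ρ i e1)) e
  run-Steps⁻ {P} {Z} {suc k} {pc} {ρ} (more {i = i} e1 e2 s) (suc f) a e
    rewrite run-step P Z f pc ρ i e1 | e2 with run-Steps⁻ s f a e
  ... | f' , eq , r = f' , cong suc eq , r

  run-mono : ∀ P Z f pc ρ a → run P Z f pc ρ ≡ just a → ∀ g → run P Z (f + g) pc ρ ≡ just a
  run-mono P Z f pc ρ a e g = by-instruction f e (nth P pc) refl
    where
    by-instruction : ∀ f → run P Z f pc ρ ≡ just a → ∀ m → nth P pc ≡ m → run P Z (f + g) pc ρ ≡ just a
    by-instruction f e nothing eqn =
      trans (run-halted P Z (f + g) pc ρ eqn) (trans (sym (run-halted P Z f pc ρ eqn)) e)
    by-instruction zero e (just i) eqn with () ← trans (sym (run-out-of-fuel P Z pc ρ i eqn)) e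
    by-instruction (suc f) e (just i) eqn =
      trans (run-step P Z (f + g) pc ρ i eqn) (run-mono P Z f _ _ a (trans (sym (run-step P Z f pc ρ i eqn)) e) g)

  run-deterministic : ∀ P Z f g pc ρ a b → run P Z f pc ρ ≡ just a → run P Z g pc ρ ≡ just b → a ≡ b
  run-deterministic P Z f g pc ρ a b e1 e2 = just-injective (begin
    just a                ≡⟨ sym (run-mono P Z f pc ρ a e1 g) ⟩
    run P Z (f + g) pc ρ  ≡⟨ cong (λ x → run P Z x pc ρ) (+-comm f g) ⟩
    run P Z (g + f) pc ρ  ≡⟨ run-mono P Z g pc ρ b e2 f ⟩
    just b                ∎)
    where open ≡-Reasoning

-- Command register r is machine register suc r; machine register 0 stays 0 in compiled code
-- and serves the unconditional jumps dec 0 j.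
module Structured where
  open Execution

  infixr 5 _⨾_
  data Cmd : Set where
    skip : Cmd
    incC : ℕ → Cmd
    orcC : ℕ → Cmd
    _⨾_  : Cmd → Cmd → Cmd
    loop : ℕ → Cmd → Cmd

  reg : Regs → ℕ → ℕ
  reg ρ k = ρ (suc k)

  data Ev (Z : Oracle) : Cmd → Regs → Regs → Set where
    skipE : ∀ {ρ} → Ev Z skip ρ ρ
    incE  : ∀ {r ρ} → Ev Z (incC r) ρ (set ρ (suc r) (suc (reg ρ r)))
    orcE  : ∀ {r ρ} → Ev Z (orcC r) ρ (set ρ (suc r) (bit (Z (reg ρ r))))
    seqE  : ∀ {c d ρ ρ1 ρ2} → Ev Z c ρ ρ1 → Ev Z d ρ1 ρ2 → Ev Z (c ⨾ d) ρ ρ2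
    loopZ : ∀ {r c ρ} → reg ρ r ≡ 0 → Ev Z (loop r c) ρ ρ
    loopS : ∀ {r c ρ v ρ1 ρ2} → reg ρ r ≡ suc v → Ev Z c (set ρ (suc r) v) ρ1 →
            Ev Z (loop r c) ρ1 ρ2 → Ev Z (loop r c) ρ ρ2

  size : Cmd → ℕ
  size skip       = 0
  size (incC r)   = 1
  size (orcC r)   = 1
  size (c ⨾ d)    = size c + size d
  size (loop r c) = suc (suc (size c))

  -- the code of c placed at address a (jumps are absolute)
  compile : Cmd → ℕ → Program
  compile skip       a = []
  compile (incC r)   a = inc (suc r) ∷ []
  compile (orcC r)   a = orc (suc r) ∷ []
  compile (c ⨾ d)    a = compile c a ++ compile d (a + size c)
  compile (loop r c) a = dec (suc r) (suc (suc (a + size c))) ∷ (compile c (suc a) ++ dec 0 a ∷ [])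

  length-compile : ∀ c a → length (compile c a) ≡ size c
  length-compile skip       a = refl
  length-compile (incC r)   a = refl
  length-compile (orcC r)   a = refl
  length-compile (c ⨾ d)    a = trans (length-++ (compile c a))
                                      (cong₂ _+_ (length-compile c a) (length-compile d (a + size c)))
  length-compile (loop r c) a = cong suc (trans (length-++ (compile c (suc a)))
                                   (trans (cong (_+ 1) (length-compile c (suc a))) (+-comm (size c) 1)))

  Ev-scratch : ∀ {Z c ρ ρ'} → Ev Z c ρ ρ' → ρ' 0 ≡ ρ 0
  Ev-scratch skipE       = refl
  Ev-scratch incE        = refl
  Ev-scratch orcE        = refl
  Ev-scratch (seqE a b)  = trans (Ev-scratch b) (Ev-scratch a)
  Ev-scratch (loopZ _)   = refl
  Ev-scratch (loopS _ a b) = trans (Ev-scratch b) (Ev-scratch a)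

  Contains : Program → ℕ → Program → Set
  Contains P a code = ∀ i x → nth code i ≡ just x → nth P (a + i) ≡ just x

  nth-++ˡ : ∀ xs ys i x → nth xs i ≡ just x → nth (xs ++ ys) i ≡ just x
  nth-++ˡ (_ ∷ xs) ys zero    x e = e
  nth-++ˡ (_ ∷ xs) ys (suc i) x e = nth-++ˡ xs ys i x e

  nth-++ʳ : ∀ xs ys i → nth (xs ++ ys) (length xs + i) ≡ nth ys i
  nth-++ʳ []       ys i = refl
  nth-++ʳ (_ ∷ xs) ys i = nth-++ʳ xs ys i

  nth-∷ʳ : ∀ xs y → nth (xs ++ y ∷ []) (length xs) ≡ just y
  nth-∷ʳ []       y = refl
  nth-∷ʳ (_ ∷ xs) y = nth-∷ʳ xs y

  Contains-++ˡ : ∀ {P a xs ys} → Contains P a (xs ++ ys) → Contains P a xs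
  Contains-++ˡ {xs = xs} {ys} h i x e = h i x (nth-++ˡ xs ys i x e)

  Contains-++ʳ : ∀ {P a xs ys} → Contains P a (xs ++ ys) → Contains P (a + length xs) ys
  Contains-++ʳ {P} {a} {xs} {ys} h i x e =
    subst (λ k → nth P k ≡ just x) (sym (+-assoc a (length xs) i)) (h (length xs + i) x (trans (nth-++ʳ xs ys i) e))

  Contains-head : ∀ {P a x code} → Contains P a (x ∷ code) → nth P a ≡ just x
  Contains-head {P} {a} h = trans (cong (nth P) (sym (+-identityʳ a))) (h 0 _ refl)

  Steps-refl : ∀ {P Z pc pc' ρ} → pc ≡ pc' → Steps P Z 0 pc ρ pc' ρ
  Steps-refl refl = done

  compile-sound : ∀ {Z c ρ ρ'} → Ev Z c ρ ρ' → ρ 0 ≡ 0 →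
                  ∀ P a → Contains P a (compile c a) → ∃[ k ] Steps P Z k a ρ (a + size c) ρ'
  compile-sound skipE z P a h = 0 , Steps-refl (sym (+-identityʳ a))
  compile-sound incE  z P a h = 1 , more (Contains-head {P} h) refl (Steps-refl (+-comm 1 a))
  compile-sound orcE  z P a h = 1 , more (Contains-head {P} h) refl (Steps-refl (+-comm 1 a))
  compile-sound {Z} {c ⨾ d} {ρ} {ρ'} (seqE {ρ1 = ρ1} ev₁ ev₂) z P a h
    with compile-sound ev₁ z P a (Contains-++ˡ {P} {xs = compile c a} h)
  ... | k₁ , s₁ with compile-sound ev₂ (trans (Ev-scratch ev₁) z) P (a + size c)
                       (subst (λ l → Contains P (a + l) (compile d (a + size c))) (length-compile c a)
                              (Contains-++ʳ {P} {xs = compile c a} h))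
  ... | k₂ , s₂ = k₁ + k₂ ,
                  Steps-++ s₁ (subst (λ x → Steps P Z k₂ (a + size c) ρ1 x ρ') (+-assoc a (size c) (size d)) s₂)
  compile-sound {Z} {loop r c} {ρ} (loopZ e) z P a h =
    1 , more (Contains-head {P} h) exit (Steps-refl (sym (trans (+-suc a (suc (size c))) (cong suc (+-suc a (size c))))))
    where
    exit : step Z (dec (suc r) (suc (suc (a + size c)))) a ρ ≡ (suc (suc (a + size c)) , ρ)
    exit rewrite e = refl
  compile-sound {Z} {loop r c} {ρ} (loopS {v = v} {ρ1 = ρ1} e ev₁ ev₂) z P a h
    with compile-sound ev₁ z P (suc a) body
    where
    body : Contains P (suc a) (compile c (suc a))
    body i x q = trans (cong (nth P) (sym (+-suc a i))) (h (suc i) x (nth-++ˡ (compile c (suc a)) _ i x q))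
  ... | k₁ , s₁ with compile-sound ev₂ (trans (Ev-scratch ev₁) z) P a h
  ... | k₂ , s₂ = suc (k₁ + (1 + k₂)) , more (Contains-head {P} h) enter (Steps-++ s₁ (more back jump s₂))
    where
    enter : step Z (dec (suc r) (suc (suc (a + size c)))) a ρ ≡ (suc a , set ρ (suc r) v)
    enter rewrite e = refl
    back : nth P (suc a + size c) ≡ just (dec 0 a)
    back = trans (cong (nth P) (sym (+-suc a (size c))))
                 (h (suc (size c)) (dec 0 a)
                    (subst (λ l → nth (compile c (suc a) ++ dec 0 a ∷ []) l ≡ just (dec 0 a))
                           (length-compile c (suc a)) (nth-∷ʳ (compile c (suc a)) (dec 0 a))))
    jump : step Z (dec 0 a) (suc a + size c) ρ1 ≡ (a , ρ1)
    jump rewrite trans (Ev-scratch ev₁) z = refl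

module Registers where
  open Structured

  set-≡ : ∀ ρ r v → set ρ r v r ≡ v
  set-≡ ρ r v with r ≟ r
  ... | yes _ = refl
  ... | no r≢r = ⊥-elim (r≢r refl)

  set-≢ : ∀ ρ r v k → k ≢ r → set ρ r v k ≡ ρ k
  set-≢ ρ r v k k≢r with k ≟ r
  ... | yes k≡r = ⊥-elim (k≢r k≡r)
  ... | no _ = refl

  reg-set-≢ : ∀ ρ r v k → k ≢ r → reg (set ρ (suc r) v) k ≡ reg ρ k
  reg-set-≢ ρ r v k k≢r = set-≢ ρ (suc r) v (suc k) (λ e → k≢r (suc-injective e))

  Untouched : ℕ → Cmd → Set
  Untouched k skip       = ⊤
  Untouched k (incC r)   = k ≢ r
  Untouched k (orcC r)   = k ≢ r
  Untouched k (c ⨾ d)    = Untouched k c × Untouched k d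
  Untouched k (loop r c) = k ≢ r × Untouched k c

  Untouched-reg : ∀ {Z c ρ ρ'} k → Untouched k c → Ev Z c ρ ρ' → reg ρ' k ≡ reg ρ k
  Untouched-reg k h skipE = refl
  Untouched-reg {ρ = ρ} k h (incE {r}) = reg-set-≢ ρ r _ k h
  Untouched-reg {ρ = ρ} k h (orcE {r}) = reg-set-≢ ρ r _ k h
  Untouched-reg k (h₁ , h₂) (seqE a b) = trans (Untouched-reg k h₂ b) (Untouched-reg k h₁ a)
  Untouched-reg k h (loopZ _) = refl
  Untouched-reg {ρ = ρ} k (h₁ , h₂) (loopS {r} {v = v} _ a b) =
    trans (Untouched-reg k (h₁ , h₂) b) (trans (Untouched-reg k h₂ a) (reg-set-≢ ρ r v k h₁))

  loop-invariant : ∀ {Z r c} (I : ℕ → Regs → Set) → (∀ n ρ → I n ρ → reg ρ r ≡ n) →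
                   (∀ n ρ → I (suc n) ρ → ∃[ ρ' ] (Ev Z c (set ρ (suc r) n) ρ' × I n ρ')) →
                   ∀ n ρ → I n ρ → ∃[ ρ' ] (Ev Z (loop r c) ρ ρ' × I 0 ρ')
  loop-invariant I counter body zero ρ i = ρ , loopZ (counter 0 ρ i) , i
  loop-invariant I counter body (suc n) ρ i with body n ρ i
  ... | ρ₁ , e₁ , i₁ with loop-invariant I counter body n ρ₁ i₁
  ... | ρ₂ , e₂ , i₂ = ρ₂ , loopS (counter (suc n) ρ i) e₁ e₂ , i₂

  clear : ℕ → Cmd
  clear r = loop r skip

  addTo : ℕ → ℕ → Cmd
  addTo s d = loop s (incC d)

  addTo₂ : ℕ → ℕ → ℕ → Cmd
  addTo₂ s d t = loop s (incC d ⨾ incC t)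

  move : ℕ → ℕ → Cmd
  move s d = clear d ⨾ addTo s d

  copy : ℕ → ℕ → ℕ → Cmd
  copy s d t = clear d ⨾ clear t ⨾ addTo₂ s d t ⨾ addTo t s

  record Distinct3 (s d t : ℕ) : Set where
    field
      s≢d : s ≢ d
      s≢t : s ≢ t
      d≢t : d ≢ t

  abstract
    clear-spec : ∀ {Z} r ρ → ∃[ ρ' ] (Ev Z (clear r) ρ ρ' × reg ρ' r ≡ 0)
    clear-spec r ρ = loop-invariant (λ n ρ → reg ρ r ≡ n) (λ n ρ i → i)
                                    (λ n ρ i → set ρ (suc r) n , skipE , set-≡ ρ (suc r) n) (reg ρ r) ρ refl

    incC-after-set : ∀ ρ s n d → s ≢ d → reg (set (set ρ (suc s) n) (suc d) (suc (reg (set ρ (suc s) n) d))) d ≡ suc (reg ρ d)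
    incC-after-set ρ s n d s≢d = trans (set-≡ _ (suc d) _) (cong suc (reg-set-≢ ρ s n d (≢-sym s≢d)))

    addTo-spec : ∀ {Z} s d → s ≢ d → ∀ ρ →
                 ∃[ ρ' ] (Ev Z (addTo s d) ρ ρ' × reg ρ' s ≡ 0 × reg ρ' d ≡ reg ρ s + reg ρ d)
    addTo-spec {Z} s d s≢d ρ = loop-invariant I (λ _ _ → proj₁) transfer (reg ρ s) ρ (refl , refl)
      where
      I : ℕ → Regs → Set
      I n ρ' = reg ρ' s ≡ n × n + reg ρ' d ≡ reg ρ s + reg ρ d
      transfer : ∀ n ρ' → I (suc n) ρ' → ∃[ ρ'' ] (Ev Z (incC d) (set ρ' (suc s) n) ρ'' × I n ρ'')
      transfer n ρ' (_ , inv) = _ , incE , trans (reg-set-≢ _ d _ s s≢d) (set-≡ ρ' (suc s) n) ,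
        trans (cong (n +_) (incC-after-set ρ' s n d s≢d)) (trans (+-suc n _) inv)

    addTo₂-spec : ∀ {Z} s d t → Distinct3 s d t → ∀ ρ →
                  ∃[ ρ' ] (Ev Z (addTo₂ s d t) ρ ρ' × reg ρ' s ≡ 0 × reg ρ' d ≡ reg ρ s + reg ρ d × reg ρ' t ≡ reg ρ s + reg ρ t)
    addTo₂-spec {Z} s d t D ρ = loop-invariant I (λ _ _ → proj₁) transfer (reg ρ s) ρ (refl , refl , refl)
      where
      open Distinct3 D
      I : ℕ → Regs → Set
      I n ρ' = reg ρ' s ≡ n × n + reg ρ' d ≡ reg ρ s + reg ρ d × n + reg ρ' t ≡ reg ρ s + reg ρ t
      transfer : ∀ n ρ' → I (suc n) ρ' → ∃[ ρ'' ] (Ev Z (incC d ⨾ incC t) (set ρ' (suc s) n) ρ'' × I n ρ'')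
      transfer n ρ' (_ , inv-d , inv-t) = _ , seqE incE incE ,
        trans (reg-set-≢ _ t _ s s≢t) (trans (reg-set-≢ _ d _ s s≢d) (set-≡ ρ' (suc s) n)) ,
        trans (cong (n +_) (trans (reg-set-≢ _ t _ d d≢t) (incC-after-set ρ' s n d s≢d))) (trans (+-suc n _) inv-d) ,
        trans (cong (n +_) (trans (set-≡ _ (suc t) _)
                                  (cong suc (trans (reg-set-≢ _ d _ t (≢-sym d≢t)) (reg-set-≢ ρ' s n t (≢-sym s≢t))))))
              (trans (+-suc n _) inv-t)

    move-spec : ∀ {Z} s d → s ≢ d → ∀ ρ → ∃[ ρ' ] (Ev Z (move s d) ρ ρ' × reg ρ' d ≡ reg ρ s)
    move-spec {Z} s d s≢d ρ with clear-spec {Z} d ρ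
    ... | ρ₁ , e₁ , d₁ with addTo-spec {Z} s d s≢d ρ₁
    ... | ρ₂ , e₂ , _ , d₂ = ρ₂ , seqE e₁ e₂ ,
          trans d₂ (trans (cong₂ _+_ (Untouched-reg s (s≢d , tt) e₁) d₁) (+-identityʳ _))

    copy-spec : ∀ {Z} s d t → Distinct3 s d t → ∀ ρ →
                ∃[ ρ' ] (Ev Z (copy s d t) ρ ρ' × reg ρ' d ≡ reg ρ s × reg ρ' s ≡ reg ρ s)
    copy-spec {Z} s d t D ρ with clear-spec {Z} d ρ
    ... | ρ₁ , e₁ , d₁ with clear-spec {Z} t ρ₁
    ... | ρ₂ , e₂ , t₂ with addTo₂-spec {Z} s d t D ρ₂
    ... | ρ₃ , e₃ , s₃ , d₃ , t₃ with addTo-spec {Z} t s (≢-sym (Distinct3.s≢t D)) ρ₃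
    ... | ρ₄ , e₄ , _ , s₄ = ρ₄ , seqE e₁ (seqE e₂ (seqE e₃ e₄)) , d-copied , s-restored
      where
      open Distinct3 D
      s₂ : reg ρ₂ s ≡ reg ρ s
      s₂ = trans (Untouched-reg s (s≢t , tt) e₂) (Untouched-reg s (s≢d , tt) e₁)
      d₂ : reg ρ₂ d ≡ 0
      d₂ = trans (Untouched-reg d (d≢t , tt) e₂) d₁
      d-copied : reg ρ₄ d ≡ reg ρ s
      d-copied = trans (Untouched-reg d (d≢t , ≢-sym s≢d) e₄)
                       (trans d₃ (trans (cong₂ _+_ s₂ d₂) (+-identityʳ _)))
      s-restored : reg ρ₄ s ≡ reg ρ s
      s-restored = trans s₄ (trans (cong₂ _+_ t₃ s₃) (trans (+-identityʳ _) (trans (cong₂ _+_ s₂ t₂) (+-identityʳ _))))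

module PrimitiveRecursive where
  open Structured
  open Registers

  -- rec2 s f₁ f₂ g₁ g₂ defines a pair by simultaneous recursion on the first argument (base f₁, f₂;
  -- steps g₁, g₂ receive the counter, both previous values and the parameters) and returns its
  -- first component if s is true, its second otherwise.
  data PR : ℕ → Set where
    const  : ∀ {n} → ℕ → PR n
    succ   : PR 1
    proj   : ∀ {n} → Fin n → PR n
    comp   : ∀ {n m} → PR m → Vec (PR n) m → PR n
    rec2   : ∀ {n} → Bool → PR n → PR n → PR (3 + n) → PR (3 + n) → PR (suc n)
    query  : PR 1

  select : Bool → ℕ × ℕ → ℕ
  select true  = proj₁
  select false = proj₂

  mutual
    ev : Oracle → ∀ {n} → PR n → Vec ℕ n → ℕ
    ev Z (const k)              xs        = k
    ev Z succ                   (x ∷ [])  = suc x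
    ev Z (proj j)               xs        = lookup xs j
    ev Z (comp f gs)            xs        = ev Z f (evs Z gs xs)
    ev Z (rec2 s f₁ f₂ g₁ g₂)   (y ∷ xs)  = select s (evRec Z f₁ f₂ g₁ g₂ y xs)
    ev Z query                  (x ∷ [])  = bit (Z x)

    evs : Oracle → ∀ {n m} → Vec (PR n) m → Vec ℕ n → Vec ℕ m
    evs Z []       xs = []
    evs Z (g ∷ gs) xs = ev Z g xs ∷ evs Z gs xs

    evRec : Oracle → ∀ {n} → PR n → PR n → PR (3 + n) → PR (3 + n) → ℕ → Vec ℕ n → ℕ × ℕ
    evRec Z f₁ f₂ g₁ g₂ zero    xs = ev Z f₁ xs , ev Z f₂ xs
    evRec Z f₁ f₂ g₁ g₂ (suc y) xs =
      let (a , b) = evRec Z f₁ f₂ g₁ g₂ y xs in ev Z g₁ (y ∷ a ∷ b ∷ xs) , ev Z g₂ (y ∷ a ∷ b ∷ xs)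

  incN : ℕ → ℕ → Cmd
  incN zero    b = skip
  incN (suc k) b = incC b ⨾ incN k b

  regsFrom : ∀ m → ℕ → Vec ℕ m
  regsFrom zero    b = []
  regsFrom (suc m) b = b ∷ regsFrom m (suc b)

  selectReg : Bool → ℕ → ℕ
  selectReg true  b = b + 1
  selectReg false b = b + 2

  recArgs : ∀ {n} → ℕ → Vec ℕ n → Vec ℕ (3 + n)
  recArgs b xs = (b + 4) ∷ (b + 1) ∷ (b + 2) ∷ xs

  -- compilePR t is b computes t on the registers is into register b, using only registers above b
  -- as scratch; for rec2, registers b+1 … b+5 hold the pair, the counter, the index and a buffer.
  mutual
    compilePR : ∀ {n} → PR n → Vec ℕ n → ℕ → Cmd
    compilePR (const k)  is       b = clear b ⨾ incN k b
    compilePR succ       (i ∷ []) b = copy i b (suc b) ⨾ incC b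
    compilePR (proj j)   is       b = copy (lookup is j) b (suc b)
    compilePR (comp {m = m} f gs) is b =
      compilePRs gs is (suc b + m) (suc b) ⨾ computeInto f (regsFrom m (suc b)) (suc b + m) b
    compilePR (rec2 s f₁ f₂ g₁ g₂) (y ∷ xs) b =
      recInit f₁ f₂ y xs b ⨾ loop (b + 3) (recBody g₁ g₂ xs b) ⨾ move (selectReg s b) b
    compilePR query (i ∷ []) b = copy i b (suc b) ⨾ orcC b

    compilePRs : ∀ {n m} → Vec (PR n) m → Vec ℕ n → ℕ → ℕ → Cmd
    compilePRs []       is B j = skip
    compilePRs (g ∷ gs) is B j = computeInto g is B j ⨾ compilePRs gs is B (suc j)

    computeInto : ∀ {n} → PR n → Vec ℕ n → ℕ → ℕ → Cmd
    computeInto t is B d = compilePR t is B ⨾ move B d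

    recInit : ∀ {n} → PR n → PR n → ℕ → Vec ℕ n → ℕ → Cmd
    recInit f₁ f₂ y xs b =
      computeInto f₁ xs (b + 6) (b + 1) ⨾ computeInto f₂ xs (b + 6) (b + 2) ⨾ copy y (b + 3) (b + 6) ⨾ clear (b + 4)

    recBody : ∀ {n} → PR (3 + n) → PR (3 + n) → Vec ℕ n → ℕ → Cmd
    recBody g₁ g₂ xs b =
      computeInto g₁ (recArgs b xs) (b + 6) (b + 5) ⨾ computeInto g₂ (recArgs b xs) (b + 6) (b + 2) ⨾
      move (b + 5) (b + 1) ⨾ incC (b + 4)

  record Frame (b : ℕ) (ρ ρ' : Regs) : Set where
    constructor frame
    field unchanged : ∀ k → k < b → reg ρ' k ≡ reg ρ k
  open Frame public

  Below : ℕ → ∀ {n} → Vec ℕ n → Set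
  Below b = All (_< b)

  Below-mono : ∀ {n a b} {is : Vec ℕ n} → a ≤ b → Below a is → Below b is
  Below-mono a≤b = All-map (λ l → <-≤-trans l a≤b)

  Frame-regs : ∀ {n b} (is : Vec ℕ n) {ρ ρ'} → Below b is → Frame b ρ ρ' → vmap (reg ρ') is ≡ vmap (reg ρ) is
  Frame-regs []       []       f = refl
  Frame-regs (i ∷ is) (l ∷ a) f = cong₂ _∷_ (unchanged f i l) (Frame-regs is a f)

  Frame-trans : ∀ {b ρ₁ ρ₂ ρ₃} → Frame b ρ₁ ρ₂ → Frame b ρ₂ ρ₃ → Frame b ρ₁ ρ₃
  Frame-trans f g = frame λ k l → trans (unchanged g k l) (unchanged f k l)

  Frame-mono : ∀ {a b ρ₁ ρ₂} → a ≤ b → Frame b ρ₁ ρ₂ → Frame a ρ₁ ρ₂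
  Frame-mono a≤b f = frame λ k l → unchanged f k (<-≤-trans l a≤b)

  Untouched-Frame : ∀ {Z c ρ ρ'} b → (∀ k → k < b → Untouched k c) → Ev Z c ρ ρ' → Frame b ρ ρ'
  Untouched-Frame b h e = frame λ k l → Untouched-reg k (h k l) e

  Computes : Oracle → ∀ {n} → PR n → Vec ℕ n → ℕ → Regs → Regs → Set
  Computes Z t is b ρ ρ' = Ev Z (compilePR t is b) ρ ρ' × reg ρ' b ≡ ev Z t (vmap (reg ρ) is) × Frame b ρ ρ'

  Compilable : Oracle → ∀ {n} → PR n → Set
  Compilable Z {n} t = ∀ (is : Vec ℕ n) b → Below b is → ∀ ρ → ∃[ ρ' ] Computes Z t is b ρ ρ'

  Keeps : ℕ → ℕ → Regs → Regs → Set
  Keeps B d ρ ρ' = ∀ k → k < B → k ≢ d → reg ρ' k ≡ reg ρ k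

  Keeps⇒Frame : ∀ {b B d ρ ρ'} → b ≤ B → b ≤ d → Keeps B d ρ ρ' → Frame b ρ ρ'
  Keeps⇒Frame b≤B b≤d h = frame λ k l → h k (<-≤-trans l b≤B) (<⇒≢ (<-≤-trans l b≤d))

  +-≢ : ∀ b {i j} → i ≢ j → b + i ≢ b + j
  +-≢ b i≢j e = i≢j (+-cancelˡ-≡ b _ _ e)

  <⇒≢+ : ∀ {k b} j → k < b → k ≢ b + j
  <⇒≢+ {k} {b} j l = <⇒≢ (≤-trans l (m≤m+n b j))

  +-<-lit : ∀ b i j → {True (i <? j)} → b + i < b + j
  +-<-lit b i j {i<j} = +-monoʳ-< b (toWitness i<j)

  move-Untouched : ∀ {k s d} → k ≢ s → k ≢ d → Untouched k (move s d)
  move-Untouched k≢s k≢d = (k≢d , tt) , (k≢s , k≢d)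

  move-reg : ∀ {Z s d ρ ρ'} k → Ev Z (move s d) ρ ρ' → k ≢ s → k ≢ d → reg ρ' k ≡ reg ρ k
  move-reg k e k≢s k≢d = Untouched-reg k (move-Untouched k≢s k≢d) e

  move-Frame : ∀ {Z s d ρ ρ'} b → Ev Z (move s d) ρ ρ' → b ≤ s → b ≤ d → Frame b ρ ρ'
  move-Frame b e b≤s b≤d = Untouched-Frame b (λ k l → move-Untouched (<⇒≢ (<-≤-trans l b≤s)) (<⇒≢ (<-≤-trans l b≤d))) e

  Distinct3-suc : ∀ {i b} → i < b → Distinct3 i b (suc b)
  Distinct3-suc {i} {b} l = record { s≢d = <⇒≢ l ; s≢t = <⇒≢ (m<n⇒m<1+n l) ; d≢t = <⇒≢ (n<1+n b) }

  copy-reg : ∀ {Z s d t ρ ρ'} → Distinct3 s d t → Ev Z (copy s d t) ρ ρ' → reg ρ' s ≡ reg ρ s →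
             ∀ k → k ≢ d → k ≢ t → reg ρ' k ≡ reg ρ k
  copy-reg {s = s} D e rs k k≢d k≢t with k ≟ s
  ... | yes refl = rs
  ... | no k≢s = Untouched-reg k ((k≢d , tt) , (k≢t , tt) , (k≢s , k≢d , k≢t) , (k≢t , k≢s)) e

  copy-Frame : ∀ {Z s d ρ ρ'} → s < d → Ev Z (copy s d (suc d)) ρ ρ' → reg ρ' s ≡ reg ρ s → Frame d ρ ρ'
  copy-Frame {d = d} s<d e rs = frame λ k k<d → copy-reg (Distinct3-suc s<d) e rs k (<⇒≢ k<d) (<⇒≢ (m<n⇒m<1+n k<d))

  Below-regsFrom : ∀ m j B → j + m ≤ B → Below B (regsFrom m j)
  Below-regsFrom zero    j B le = []
  Below-regsFrom (suc m) j B le =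
    ≤-trans (s≤s (m≤m+n j m)) (subst (_≤ B) (+-suc j m) le) ∷ Below-regsFrom m (suc j) B (subst (_≤ B) (+-suc j m) le)

  n<1+n+m : ∀ n m → n < suc n + m
  n<1+n+m n m = s≤s (m≤m+n n m)

  m+1+n≤o⇒m<o : ∀ m {n o} → m + suc n ≤ o → m < o
  m+1+n≤o⇒m<o m {n} le = <-≤-trans (m<m+n m (s≤s z≤n)) le

  recArgs-Below : ∀ {n b} {xs : Vec ℕ n} → Below b xs → Below (b + 6) (recArgs b xs)
  recArgs-Below {b = b} xs<b = +-<-lit b 4 6 ∷ +-<-lit b 1 6 ∷ +-<-lit b 2 6 ∷ Below-mono (m≤m+n b 6) xs<b

  computeInto-spec : ∀ {Z n} {t : PR n} → Compilable Z t → ∀ is B d → Below B is → d < B → ∀ ρ →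
                     ∃[ ρ' ] (Ev Z (computeInto t is B d) ρ ρ' × reg ρ' d ≡ ev Z t (vmap (reg ρ) is) × Keeps B d ρ ρ')
  computeInto-spec {Z} T is B d is<B d<B ρ with T is B is<B ρ
  ... | ρ₁ , e₁ , v₁ , f₁ with move-spec {Z} B d (≢-sym (<⇒≢ d<B)) ρ₁
  ... | ρ₂ , e₂ , v₂ = ρ₂ , seqE e₁ e₂ , trans v₂ v₁ ,
                       λ k k<B k≢d → trans (move-reg k e₂ (<⇒≢ k<B) k≢d) (unchanged f₁ k k<B)

  -- After m more iterations the recursion of rec2 has reached index idx, with idx + m the recursion argument.
  record RecInv (Z : Oracle) {n : ℕ} (f₁ f₂ : PR n) (g₁ g₂ : PR (3 + n)) (xs : Vec ℕ n) (b y : ℕ)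
                (ρ : Regs) (m : ℕ) (ρ' : Regs) : Set where
    field
      frm     : Frame b ρ ρ'
      counter : reg ρ' (b + 3) ≡ m
      idx     : ℕ
      idx+m   : idx + m ≡ y
      reg-idx : reg ρ' (b + 4) ≡ idx
      reg-fst : reg ρ' (b + 1) ≡ proj₁ (evRec Z f₁ f₂ g₁ g₂ idx xs)
      reg-snd : reg ρ' (b + 2) ≡ proj₂ (evRec Z f₁ f₂ g₁ g₂ idx xs)

  recBody-step : ∀ Z {n} (f₁ f₂ : PR n) (g₁ g₂ : PR (3 + n)) xs b y ρ → Below b xs → Compilable Z g₁ → Compilable Z g₂ →
                 ∀ m σ → RecInv Z f₁ f₂ g₁ g₂ (vmap (reg ρ) xs) b y ρ (suc m) σ →
                 ∃[ σ' ] (Ev Z (recBody g₁ g₂ xs b) (set σ (suc (b + 3)) m) σ' × RecInv Z f₁ f₂ g₁ g₂ (vmap (reg ρ) xs) b y ρ m σ')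
  recBody-step Z {n} f₁ f₂ g₁ g₂ xs b y ρ xs<b G₁ G₂ m σ I
    with computeInto-spec G₁ (recArgs b xs) (b + 6) (b + 5) (recArgs-Below xs<b) (+-<-lit b 5 6) (set σ (suc (b + 3)) m)
  ... | σ₁ , e₁ , w₁ , K₁ with computeInto-spec G₂ (recArgs b xs) (b + 6) (b + 2) (recArgs-Below xs<b) (+-<-lit b 2 6) σ₁
  ... | σ₂ , e₂ , w₂ , K₂ with move-spec {Z} (b + 5) (b + 1) (+-≢ b (λ ())) σ₂
  ... | σ₃ , e₃ , w₃ = σ₄ , seqE e₁ (seqE e₂ (seqE e₃ incE)) , inv
    where
    open RecInv I
    xsv : Vec ℕ n
    xsv = vmap (reg ρ) xs
    σ₀ σ₄ : Regs
    σ₀ = set σ (suc (b + 3)) m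
    σ₄ = set σ₃ (suc (b + 4)) (suc (reg σ₃ (b + 4)))
    at₀ : ∀ k → k ≢ b + 3 → reg σ₀ k ≡ reg σ k
    at₀ k ne = reg-set-≢ σ (b + 3) m k ne
    F₀ : Frame b σ σ₀
    F₀ = frame λ k l → at₀ k (<⇒≢+ 3 l)
    F₁ : Frame b σ₀ σ₁
    F₁ = Keeps⇒Frame (m≤m+n b 6) (m≤m+n b 5) K₁
    kept₀₂ : ∀ j → j < 6 → j ≢ 5 → j ≢ 2 → reg σ₂ (b + j) ≡ reg σ₀ (b + j)
    kept₀₂ j l j≢5 j≢2 = trans (K₂ (b + j) (+-monoʳ-< b l) (+-≢ b j≢2)) (K₁ (b + j) (+-monoʳ-< b l) (+-≢ b j≢5))
    kept₂₄ : ∀ j → j ≢ 4 → j ≢ 5 → j ≢ 1 → reg σ₄ (b + j) ≡ reg σ₂ (b + j)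
    kept₂₄ j j≢4 j≢5 j≢1 = trans (reg-set-≢ σ₃ (b + 4) _ (b + j) (+-≢ b j≢4)) (move-reg (b + j) e₃ (+-≢ b j≢5) (+-≢ b j≢1))
    args₀ : vmap (reg σ₀) (recArgs b xs) ≡
            idx ∷ proj₁ (evRec Z f₁ f₂ g₁ g₂ idx xsv) ∷ proj₂ (evRec Z f₁ f₂ g₁ g₂ idx xsv) ∷ xsv
    args₀ = cong₂ _∷_ (trans (at₀ (b + 4) (+-≢ b (λ ()))) reg-idx)
              (cong₂ _∷_ (trans (at₀ (b + 1) (+-≢ b (λ ()))) reg-fst)
                (cong₂ _∷_ (trans (at₀ (b + 2) (+-≢ b (λ ()))) reg-snd)
                  (Frame-regs xs xs<b (Frame-trans frm F₀))))
    args₁ : vmap (reg σ₁) (recArgs b xs) ≡ vmap (reg σ₀) (recArgs b xs)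
    args₁ = cong₂ _∷_ (K₁ (b + 4) (+-<-lit b 4 6) (+-≢ b (λ ())))
              (cong₂ _∷_ (K₁ (b + 1) (+-<-lit b 1 6) (+-≢ b (λ ())))
                (cong₂ _∷_ (K₁ (b + 2) (+-<-lit b 2 6) (+-≢ b (λ ()))) (Frame-regs xs xs<b F₁)))
    inv : RecInv Z f₁ f₂ g₁ g₂ xsv b y ρ m σ₄
    inv = record
      { frm     = Frame-trans frm (Frame-trans F₀ (Frame-trans F₁ (Frame-trans (Keeps⇒Frame (m≤m+n b 6) (m≤m+n b 2) K₂)
                    (Frame-trans (move-Frame b e₃ (m≤m+n b 5) (m≤m+n b 1)) (frame λ k l → reg-set-≢ σ₃ (b + 4) _ k (<⇒≢+ 4 l))))))
      ; counter = trans (kept₂₄ 3 (λ ()) (λ ()) (λ ())) (trans (kept₀₂ 3 (from-yes (3 <? 6)) (λ ()) (λ ())) (set-≡ σ (suc (b + 3)) m))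
      ; idx     = suc idx
      ; idx+m   = trans (sym (+-suc idx m)) idx+m
      ; reg-idx = trans (set-≡ σ₃ (suc (b + 4)) _) (cong suc (trans (move-reg (b + 4) e₃ (+-≢ b (λ ())) (+-≢ b (λ ())))
                    (trans (kept₀₂ 4 (from-yes (4 <? 6)) (λ ()) (λ ())) (trans (at₀ (b + 4) (+-≢ b (λ ()))) reg-idx))))
      ; reg-fst = trans (reg-set-≢ σ₃ (b + 4) _ (b + 1) (+-≢ b (λ ()))) (trans w₃ (trans (K₂ (b + 5) (+-<-lit b 5 6) (+-≢ b (λ ())))
                    (trans w₁ (cong (ev Z g₁) args₀))))
      ; reg-snd = trans (kept₂₄ 2 (λ ()) (λ ()) (λ ())) (trans w₂ (cong (ev Z g₂) (trans args₁ args₀)))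
      }

  counter-distinct : ∀ {y b} → y < b → Distinct3 y (b + 3) (b + 6)
  counter-distinct {b = b} y<b = record { s≢d = <⇒≢+ 3 y<b ; s≢t = <⇒≢+ 6 y<b ; d≢t = +-≢ b (λ ()) }

  recInit-spec : ∀ Z {n} (f₁ f₂ : PR n) (g₁ g₂ : PR (3 + n)) y xs b → Below b (y ∷ xs) → ∀ ρ →
                 Compilable Z f₁ → Compilable Z f₂ →
                 ∃[ ρ' ] (Ev Z (recInit f₁ f₂ y xs b) ρ ρ' × RecInv Z f₁ f₂ g₁ g₂ (vmap (reg ρ) xs) b (reg ρ y) ρ (reg ρ y) ρ')
  recInit-spec Z f₁ f₂ g₁ g₂ y xs b (y<b ∷ xs<b) ρ F₁ F₂
    with computeInto-spec F₁ xs (b + 6) (b + 1) (Below-mono (m≤m+n b 6) xs<b) (+-<-lit b 1 6) ρ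
  ... | ρ₁ , e₁ , w₁ , K₁ with computeInto-spec F₂ xs (b + 6) (b + 2) (Below-mono (m≤m+n b 6) xs<b) (+-<-lit b 2 6) ρ₁
  ... | ρ₂ , e₂ , w₂ , K₂ with copy-spec {Z} y (b + 3) (b + 6) (counter-distinct y<b) ρ₂
  ... | ρ₃ , e₃ , w₃ , y₃ with clear-spec {Z} (b + 4) ρ₃
  ... | ρ₄ , e₄ , w₄ = ρ₄ , seqE e₁ (seqE e₂ (seqE e₃ e₄)) , record
         { frm     = Frame-trans fr₂ (Frame-trans (frame λ k l → copy-reg (counter-distinct y<b) e₃ y₃ k (<⇒≢+ 3 l) (<⇒≢+ 6 l))
                                                  (Untouched-Frame b (λ k l → <⇒≢+ 4 l , tt) e₄))
         ; counter = trans (Untouched-reg (b + 3) (+-≢ b (λ ()) , tt) e₄) (trans w₃ (unchanged fr₂ y y<b))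
         ; idx     = 0
         ; idx+m   = refl
         ; reg-idx = w₄
         ; reg-fst = trans (kept₂₄ 1 (λ ()) (λ ()) (λ ())) (trans (K₂ (b + 1) (+-<-lit b 1 6) (+-≢ b (λ ()))) w₁)
         ; reg-snd = trans (kept₂₄ 2 (λ ()) (λ ()) (λ ())) (trans w₂ (cong (ev Z f₂) (Frame-regs xs xs<b fr₁)))
         }
    where
    fr₁ : Frame b ρ ρ₁
    fr₁ = Keeps⇒Frame (m≤m+n b 6) (m≤m+n b 1) K₁
    fr₂ : Frame b ρ ρ₂
    fr₂ = Frame-trans fr₁ (Keeps⇒Frame (m≤m+n b 6) (m≤m+n b 2) K₂)
    kept₂₄ : ∀ j → j ≢ 4 → j ≢ 3 → j ≢ 6 → reg ρ₄ (b + j) ≡ reg ρ₂ (b + j)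
    kept₂₄ j j≢4 j≢3 j≢6 = trans (Untouched-reg (b + j) (+-≢ b j≢4 , tt) e₄)
                                 (copy-reg (counter-distinct y<b) e₃ y₃ (b + j) (+-≢ b j≢3) (+-≢ b j≢6))

  compile-rec2-correct : ∀ Z {n} s (f₁ f₂ : PR n) (g₁ g₂ : PR (3 + n)) y xs b → Below b (y ∷ xs) → ∀ ρ →
                         Compilable Z f₁ → Compilable Z f₂ → Compilable Z g₁ → Compilable Z g₂ →
                         ∃[ ρ' ] Computes Z (rec2 s f₁ f₂ g₁ g₂) (y ∷ xs) b ρ ρ'
  compile-rec2-correct Z s f₁ f₂ g₁ g₂ y xs b (y<b ∷ xs<b) ρ F₁ F₂ G₁ G₂ =
    let (ρ₁ , e₁ , I₁) = recInit-spec Z f₁ f₂ g₁ g₂ y xs b (y<b ∷ xs<b) ρ F₁ F₂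
        (ρ₂ , e₂ , I₂) = loop-invariant (RecInv Z f₁ f₂ g₁ g₂ (vmap (reg ρ) xs) b (reg ρ y) ρ) (λ _ _ → RecInv.counter)
                           (recBody-step Z f₁ f₂ g₁ g₂ xs b (reg ρ y) ρ xs<b G₁ G₂) (reg ρ y) ρ₁ I₁
        (ρ₃ , e₃ , w₃) = move-spec {Z} (selectReg s b) b (selectReg≢ s) ρ₂
    in ρ₃ , seqE e₁ (seqE e₂ e₃) ,
       trans w₃ (trans (selected I₂ s)
         (cong (λ i → select s (evRec Z f₁ f₂ g₁ g₂ i (vmap (reg ρ) xs))) (trans (sym (+-identityʳ _)) (RecInv.idx+m I₂)))) ,
       Frame-trans (RecInv.frm I₂) (move-Frame b e₃ (selectReg≥ s) ≤-refl)
    where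
    selectReg≥ : ∀ s → b ≤ selectReg s b
    selectReg≥ true  = m≤m+n b 1
    selectReg≥ false = m≤m+n b 2
    selectReg≢ : ∀ s → selectReg s b ≢ b
    selectReg≢ true  e = <⇒≢ (+-<-lit b 0 1) (trans (+-identityʳ b) (sym e))
    selectReg≢ false e = <⇒≢ (+-<-lit b 0 2) (trans (+-identityʳ b) (sym e))
    selected : ∀ {m σ} (I : RecInv Z f₁ f₂ g₁ g₂ (vmap (reg ρ) xs) b (reg ρ y) ρ m σ) →
               ∀ s → reg σ (selectReg s b) ≡ select s (evRec Z f₁ f₂ g₁ g₂ (RecInv.idx I) (vmap (reg ρ) xs))
    selected I true  = RecInv.reg-fst I
    selected I false = RecInv.reg-snd I

  mutual
    compilePR-correct : ∀ Z {n} (t : PR n) → Compilable Z t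
    compilePR-correct Z (const k) is b a ρ with clear-spec {Z} b ρ
    ... | ρ₁ , e₁ , z₁ with incN-spec k ρ₁
      where
      incN-spec : ∀ k ρ → ∃[ ρ' ] (Ev Z (incN k b) ρ ρ' × reg ρ' b ≡ k + reg ρ b × Frame b ρ ρ')
      incN-spec zero ρ = ρ , skipE , refl , frame λ _ _ → refl
      incN-spec (suc k) ρ with incN-spec k (set ρ (suc b) (suc (ρ (suc b))))
      ... | ρ' , e , v , f = ρ' , seqE incE e , trans v (trans (cong (k +_) (set-≡ ρ (suc b) _)) (+-suc k _)) ,
                             frame λ j l → trans (unchanged f j l) (reg-set-≢ ρ b _ j (<⇒≢ l))
    ... | ρ₂ , e₂ , v₂ , f₂ = ρ₂ , seqE e₁ e₂ , trans v₂ (trans (cong (k +_) z₁) (+-identityʳ k)) ,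
                              Frame-trans (Untouched-Frame b (λ j l → <⇒≢ l , tt) e₁) f₂
    compilePR-correct Z succ (i ∷ []) b (l ∷ []) ρ with copy-spec {Z} i b (suc b) (Distinct3-suc l) ρ
    ... | ρ₁ , e₁ , v₁ , r₁ = set ρ₁ (suc b) (suc (ρ₁ (suc b))) , seqE e₁ incE , trans (set-≡ ρ₁ (suc b) _) (cong suc v₁) ,
                              Frame-trans (copy-Frame l e₁ r₁) (frame λ j jl → reg-set-≢ ρ₁ b _ j (<⇒≢ jl))
    compilePR-correct Z (proj j) is b a ρ with copy-spec {Z} (lookup is j) b (suc b) (Distinct3-suc (lookup⁺ a j)) ρ
    ... | ρ₁ , e₁ , v₁ , r₁ = ρ₁ , e₁ , trans v₁ (sym (lookup-map j (reg ρ) is)) , copy-Frame (lookup⁺ a j) e₁ r₁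
    compilePR-correct Z query (i ∷ []) b (l ∷ []) ρ with copy-spec {Z} i b (suc b) (Distinct3-suc l) ρ
    ... | ρ₁ , e₁ , v₁ , r₁ = set ρ₁ (suc b) (bit (Z (ρ₁ (suc b)))) , seqE e₁ orcE ,
                              trans (set-≡ ρ₁ (suc b) _) (cong (λ x → bit (Z x)) v₁) ,
                              Frame-trans (copy-Frame l e₁ r₁) (frame λ j jl → reg-set-≢ ρ₁ b _ j (<⇒≢ jl))
    compilePR-correct Z (comp {m = m} f gs) is b a ρ
      with compilePRs-correct Z gs is (suc b + m) (suc b) (Below-mono (n≤1+n b) a) ≤-refl ρ
    ... | ρ₁ , e₁ , v₁ , f₁
      with computeInto-spec (compilePR-correct Z f) (regsFrom m (suc b)) (suc b + m) b
                            (Below-regsFrom m (suc b) (suc b + m) ≤-refl) (n<1+n+m b m) ρ₁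
    ... | ρ₂ , e₂ , v₂ , K₂ = ρ₂ , seqE e₁ e₂ , trans v₂ (cong (ev Z f) v₁) ,
          Frame-trans (Frame-mono (n≤1+n b) f₁) (Keeps⇒Frame (<⇒≤ (n<1+n+m b m)) ≤-refl K₂)
    compilePR-correct Z (rec2 s f₁ f₂ g₁ g₂) (y ∷ xs) b a ρ =
      compile-rec2-correct Z s f₁ f₂ g₁ g₂ y xs b a ρ
        (compilePR-correct Z f₁) (compilePR-correct Z f₂) (compilePR-correct Z g₁) (compilePR-correct Z g₂)

    compilePRs-correct : ∀ Z {n m} (gs : Vec (PR n) m) is B j → Below j is → j + m ≤ B → ∀ ρ →
                         ∃[ ρ' ] (Ev Z (compilePRs gs is B j) ρ ρ' × vmap (reg ρ') (regsFrom m j) ≡ evs Z gs (vmap (reg ρ) is)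
                                  × Frame j ρ ρ')
    compilePRs-correct Z [] is B j a le ρ = ρ , skipE , refl , frame λ _ _ → refl
    compilePRs-correct Z {m = suc m} (g ∷ gs) is B j a le ρ
      with computeInto-spec (compilePR-correct Z g) is B j (Below-mono (<⇒≤ (m+1+n≤o⇒m<o j le)) a) (m+1+n≤o⇒m<o j le) ρ
    ... | ρ₁ , e₁ , v₁ , K₁ with compilePRs-correct Z gs is B (suc j) (Below-mono (n≤1+n j) a) (subst (_≤ B) (+-suc j m) le) ρ₁
    ... | ρ₂ , e₂ , v₂ , f₂ = ρ₂ , seqE e₁ e₂ ,
          cong₂ _∷_ (trans (unchanged f₂ j ≤-refl) v₁) (trans v₂ (cong (evs Z gs) (Frame-regs is a fr₁))) ,
          Frame-trans fr₁ (Frame-mono (n≤1+n j) f₂)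
      where
      fr₁ : Frame j ρ ρ₁
      fr₁ = Keeps⇒Frame (<⇒≤ (m+1+n≤o⇒m<o j le)) ≤-refl K₁

-- The searcher moves its input x from machine register 0 to 1 and then, for w = 0, 1, …
-- (register 2), computes chk (x , w) into register 3, halting as soon as it is nonzero.
module Search (chk : PrimitiveRecursive.PR 2) where
  open PrimitiveRecursive using (PR; ev; compilePR; compilePR-correct; unchanged)
  open Execution
  open Structured
  open Registers using (set-≡)

  body : Cmd
  body = compilePR chk (0 ∷ 1 ∷ []) 2

  ℓ : ℕ
  ℓ = size body

  prologue epilogue : Program
  prologue = dec 0 3 ∷ inc 1 ∷ dec 2 0 ∷ []
  epilogue = dec 3 (5 + ℓ) ∷ dec 0 (7 + ℓ) ∷ inc 2 ∷ dec 0 3 ∷ []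

  searcher : Program
  searcher = prologue ++ (compile body 3 ++ epilogue)

  epilogue-at : ∀ j → nth searcher (j + (3 + ℓ)) ≡ nth epilogue j
  epilogue-at j = begin
    nth searcher (j + (3 + ℓ))                                      ≡⟨ cong (nth searcher) (+-comm j (3 + ℓ)) ⟩
    nth (compile body 3 ++ epilogue) (ℓ + j)                        ≡⟨ cong (λ l → nth (compile body 3 ++ epilogue) (l + j))
                                                                             (sym (length-compile body 3)) ⟩
    nth (compile body 3 ++ epilogue) (length (compile body 3) + j)  ≡⟨ nth-++ʳ (compile body 3) epilogue j ⟩
    nth epilogue j                                                  ∎
    where open ≡-Reasoning

  body-placed : Contains searcher 3 (compile body 3)
  body-placed i x e = nth-++ˡ (compile body 3) epilogue i x e

  record LoopHead (x w : ℕ) (ρ : Regs) : Set where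
    field
      scratch  : ρ 0 ≡ 0
      argument : ρ 1 ≡ x
      witness  : ρ 2 ≡ w

  check : Oracle → ℕ → ℕ → ℕ
  check Z x w = ev Z chk (x ∷ w ∷ [])

  run-body : ∀ Z x w ρ → LoopHead x w ρ →
             ∃[ k ] ∃[ ρ' ] (Steps searcher Z k 3 ρ (3 + ℓ) ρ' × ρ' 3 ≡ check Z x w × LoopHead x w ρ')
  run-body Z x w ρ H with compilePR-correct Z chk (0 ∷ 1 ∷ []) 2 (s≤s z≤n ∷ s≤s (s≤s z≤n) ∷ []) ρ
  ... | ρ' , e , v , f with compile-sound e (LoopHead.scratch H) searcher 3 body-placed
  ... | k , st = k , ρ' , st ,
                 trans v (cong₂ (λ a b → ev Z chk (a ∷ b ∷ [])) (LoopHead.argument H) (LoopHead.witness H)) ,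
                 record { scratch = trans (Ev-scratch e) (LoopHead.scratch H)
                        ; argument = trans (unchanged f 0 (s≤s z≤n)) (LoopHead.argument H)
                        ; witness = trans (unchanged f 1 (s≤s (s≤s z≤n))) (LoopHead.witness H) }

  continue : ∀ Z x w ρ → ρ 3 ≡ 0 → LoopHead x w ρ → ∃[ ρ' ] (Steps searcher Z 3 (3 + ℓ) ρ 3 ρ' × LoopHead x (suc w) ρ')
  continue Z x w ρ e3 H = set ρ 2 (suc (ρ 2)) ,
    more (epilogue-at 0) test (more (epilogue-at 2) refl (more (epilogue-at 3) jump done)) ,
    record { scratch = LoopHead.scratch H ; argument = LoopHead.argument H
           ; witness = trans (set-≡ ρ 2 _) (cong suc (LoopHead.witness H)) }
    where
    test : step Z (dec 3 (5 + ℓ)) (3 + ℓ) ρ ≡ (5 + ℓ , ρ)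
    test rewrite e3 = refl
    jump : step Z (dec 0 3) (6 + ℓ) (set ρ 2 (suc (ρ 2))) ≡ (3 , set ρ 2 (suc (ρ 2)))
    jump rewrite LoopHead.scratch H = refl

  stop : ∀ Z ρ v → ρ 3 ≡ suc v → ρ 0 ≡ 0 → ∃[ a ] (run searcher Z 2 (3 + ℓ) ρ ≡ just a)
  stop Z ρ v e3 e0 = _ , run-Steps⁺ {searcher} {Z} (more (epilogue-at 0) test (more (epilogue-at 1) exit done)) 0 _
                                    (run-halted searcher Z 0 (7 + ℓ) _ (epilogue-at 4))
    where
    test : step Z (dec 3 (5 + ℓ)) (3 + ℓ) ρ ≡ (4 + ℓ , set ρ 3 v)
    test rewrite e3 = refl
    exit : step Z (dec 0 (7 + ℓ)) (4 + ℓ) (set ρ 3 v) ≡ (7 + ℓ , set ρ 3 v)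
    exit rewrite e0 = refl

  prologue-steps : ∀ Z j ρ → ρ 0 ≡ j → ρ 2 ≡ 0 →
                   ∃[ k ] ∃[ ρ' ] (Steps searcher Z k 0 ρ 3 ρ' × ρ' 0 ≡ 0 × ρ' 1 ≡ j + ρ 1 × ρ' 2 ≡ 0)
  prologue-steps Z zero ρ e0 e2 = 1 , ρ , more refl exit done , e0 , refl , e2
    where
    exit : step Z (dec 0 3) 0 ρ ≡ (3 , ρ)
    exit rewrite e0 = refl
  prologue-steps Z (suc j) ρ e0 e2 with prologue-steps Z j (set (set ρ 0 j) 1 (suc (set ρ 0 j 1))) refl e2
  ... | k , ρ' , st , a0 , a1 , a2 = 3 + k , ρ' , more refl take (more refl refl (more refl back st)) ,
                                     a0 , trans a1 (+-suc j (ρ 1)) , a2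
    where
    ρ₁ ρ₂ : Regs
    ρ₁ = set ρ 0 j
    ρ₂ = set ρ₁ 1 (suc (ρ₁ 1))
    take : step Z (dec 0 3) 0 ρ ≡ (1 , ρ₁)
    take rewrite e0 = refl
    back : step Z (dec 2 0) 2 ρ₂ ≡ (0 , ρ₂)
    back rewrite e2 = refl

  reach-loop : ∀ Z x → ∃[ k ] ∃[ ρ ] (Steps searcher Z k 0 (input x) 3 ρ × LoopHead x 0 ρ)
  reach-loop Z x with prologue-steps Z x (input x) refl refl
  ... | k , ρ , st , a0 , a1 , a2 = k , ρ , st , record { scratch = a0 ; argument = trans a1 (+-identityʳ x) ; witness = a2 }

  module _ (Z : Oracle) (x : ℕ) where
    loop-halts : ∀ w₀ v → check Z x w₀ ≡ suc v → ∀ d w ρ → LoopHead x w ρ → w + d ≡ w₀ →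
                 ∃[ f ] ∃[ a ] (run searcher Z f 3 ρ ≡ just a)
    loop-halts w₀ v found d w ρ H w+d≡w₀ with run-body Z x w ρ H
    ... | k , ρ' , st , e3 , H' = by-check d w+d≡w₀ (check Z x w) refl
      where
      by-check : ∀ d → w + d ≡ w₀ → ∀ m → check Z x w ≡ m → ∃[ f ] ∃[ a ] (run searcher Z f 3 ρ ≡ just a)
      by-check d _ (suc v') eq with stop Z ρ' v' (trans e3 eq) (LoopHead.scratch H')
      ... | a , r = k + 2 , a , run-Steps⁺ st 2 a r
      by-check zero eqd zero eq =
        ⊥-elim (0≢1+n (trans (sym eq) (trans (cong (check Z x) (trans (sym (+-identityʳ w)) eqd)) found)))
      by-check (suc d') eqd zero eq with continue Z x w ρ' (trans e3 eq) H'
      ... | ρ'' , st₂ , H'' with loop-halts w₀ v found d' (suc w) ρ'' H'' (trans (sym (+-suc w d')) eqd)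
      ... | f , a , r = (k + 3) + f , a , run-Steps⁺ (Steps-++ st st₂) f a r

    loop-witness : ∀ f → Acc _<_ f → ∀ a w ρ → LoopHead x w ρ → run searcher Z f 3 ρ ≡ just a →
                   ∃[ w' ] ∃[ v ] (check Z x w' ≡ suc v)
    loop-witness f (acc rs) a w ρ H r with run-body Z x w ρ H
    ... | k , ρ' , st , e3 , H' = by-check (check Z x w) refl
      where
      by-check : ∀ m → check Z x w ≡ m → ∃[ w' ] ∃[ v ] (check Z x w' ≡ suc v)
      by-check (suc v') eq = w , v' , eq
      by-check zero eq with continue Z x w ρ' (trans e3 eq) H'
      ... | ρ'' , st₂ , H'' with run-Steps⁻ (Steps-++ st st₂) f a r
      ... | f' , eqf , r' = loop-witness f' (rs f'<f) a (suc w) ρ'' H'' r'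
        where
        f'<f : f' < f
        f'<f = subst (f' <_) (sym eqf) (subst (λ t → f' < t + f') (+-comm 3 k) (s≤s (m≤n+m f' (2 + k))))

  searcher-witness : ∀ Z x → Halts searcher Z x → ∃[ w ] ∃[ v ] (check Z x w ≡ suc v)
  searcher-witness Z x (f , a , r) with reach-loop Z x
  ... | k , ρ , st , H with run-Steps⁻ st f a r
  ... | f' , _ , r' = loop-witness Z x f' (<-wellFounded f') a 0 ρ H r'

  searcher-halts : ∀ Z x w v → check Z x w ≡ suc v → Halts searcher Z x
  searcher-halts Z x w v e with reach-loop Z x
  ... | k , ρ , st , H with loop-halts Z x w v e w 0 ρ H refl
  ... | f , a , r = k + f , a , run-Steps⁺ st f a r

iterate : ∀ {A : Set} → (A → A) → ℕ → A → A
iterate f zero    x = x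
iterate f (suc k) x = f (iterate f k x)

iterate-suc : ∀ {A : Set} (f : A → A) k x → iterate f (suc k) x ≡ iterate f k (f x)
iterate-suc f zero    x = refl
iterate-suc f (suc k) x = cong f (iterate-suc f k x)

iterate-fixed : ∀ {A : Set} (f : A → A) x → f x ≡ x → ∀ k → iterate f k x ≡ x
iterate-fixed f x e zero    = refl
iterate-fixed f x e (suc k) = trans (cong f (iterate-fixed f x e k)) e

ifZero : ∀ {A : Set} → ℕ → A → A → A
ifZero zero    x y = x
ifZero (suc c) x y = y

nextPair : ℕ × ℕ → ℕ × ℕ
nextPair (zero  , b) = suc b , 0
nextPair (suc a , b) = a , suc b

-- The inverse of the Cantor pairing, enumerating the pairs along the diagonals.
unpair : ℕ → ℕ × ℕ
unpair zero    = 0 , 0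
unpair (suc k) = nextPair (unpair k)

pair-suc : ∀ a b → pair a (suc b) ≡ suc (pair (suc a) b)
pair-suc a b = trans (cong (λ t → tri t + suc b) (+-suc a b)) (+-suc (tri (suc (a + b))) b)

pair-diag : ∀ d → pair (suc d) 0 ≡ suc (pair 0 d)
pair-diag d rewrite +-identityʳ d | +-identityʳ (d + tri d) = cong suc (+-comm d (tri d))

pair-nextPair : ∀ p → pair (proj₁ (nextPair p)) (proj₂ (nextPair p)) ≡ suc (pair (proj₁ p) (proj₂ p))
pair-nextPair (zero  , b) = pair-diag b
pair-nextPair (suc a , b) = pair-suc a b

pair-unpair : ∀ q → pair (proj₁ (unpair q)) (proj₂ (unpair q)) ≡ q
pair-unpair zero    = refl
pair-unpair (suc q) = trans (pair-nextPair (unpair q)) (cong suc (pair-unpair q))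

unpair-pair : ∀ a b → unpair (pair a b) ≡ (a , b)
unpair-pair a b = go (pair a b) a b refl
  where
  pair≡0 : ∀ a b → pair a b ≡ 0 → (a ≡ 0) × (b ≡ 0)
  pair≡0 zero    zero    e = refl , refl
  pair≡0 zero    (suc b) e = ⊥-elim (0≢1+n (sym (trans (sym (pair-suc 0 b)) e)))
  pair≡0 (suc a) zero    e = ⊥-elim (0≢1+n (sym (trans (sym (pair-diag a)) e)))
  pair≡0 (suc a) (suc b) e = ⊥-elim (0≢1+n (sym (trans (sym (pair-suc (suc a) b)) e)))
  go : ∀ m a b → pair a b ≡ m → unpair m ≡ (a , b)
  go zero a b e with pair≡0 a b e
  ... | refl , refl = refl
  go (suc m) a       (suc b) e = cong nextPair (go m (suc a) b (suc-injective (trans (sym (pair-suc a b)) e)))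
  go (suc m) zero    zero    ()
  go (suc m) (suc d) zero    e = cong nextPair (go m 0 d (suc-injective (trans (sym (pair-diag d)) e)))

∸+∸≡∣-∣ : ∀ m n → (m ∸ n) + (n ∸ m) ≡ ∣ m - n ∣
∸+∸≡∣-∣ zero    zero    = refl
∸+∸≡∣-∣ zero    (suc n) = refl
∸+∸≡∣-∣ (suc m) zero    = +-identityʳ (suc m)
∸+∸≡∣-∣ (suc m) (suc n) = ∸+∸≡∣-∣ m n

+≡0 : ∀ m {n} → m + n ≡ 0 → m ≡ 0 × n ≡ 0
+≡0 m e = m+n≡0⇒m≡0 m e , m+n≡0⇒n≡0 m e

+≡0⁵ : ∀ {a b c d f} → a + (b + (c + (d + f))) ≡ 0 → a ≡ 0 × b ≡ 0 × c ≡ 0 × d ≡ 0 × f ≡ 0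
+≡0⁵ {a} {b} {c} {d} e =
  let a≡0 , e₁ = +≡0 a e ; b≡0 , e₂ = +≡0 b e₁ ; c≡0 , e₃ = +≡0 c e₂ ; d≡0 , f≡0 = +≡0 d e₃
  in a≡0 , b≡0 , c≡0 , d≡0 , f≡0

∣-∣≡suc : ∀ m n → m ≢ n → ∃[ k ] (∣ m - n ∣ ≡ suc k)
∣-∣≡suc m n m≢n with ∣ m - n ∣ in eq
... | zero  = ⊥-elim (m≢n (∣m-n∣≡0⇒m≡n eq))
... | suc k = k , refl

module ArithmeticPR where
  open PrimitiveRecursive

  infixl 9 _⟨_⟩
  _⟨_⟩ : ∀ {n m} → PR m → Vec (PR n) m → PR n
  f ⟨ gs ⟩ = comp f gs

  p0 : ∀ {n} → PR (1 + n)
  p0 = proj (# 0)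
  p1 : ∀ {n} → PR (2 + n)
  p1 = proj (# 1)
  p2 : ∀ {n} → PR (3 + n)
  p2 = proj (# 2)
  p3 : ∀ {n} → PR (4 + n)
  p3 = proj (# 3)
  p4 : ∀ {n} → PR (5 + n)
  p4 = proj (# 4)

  k0 : ∀ {n} → PR n
  k0 = const 0

  S : ∀ {n} → PR n → PR n
  S t = succ ⟨ t ∷ [] ⟩

  predP : PR 1
  predP = rec2 true k0 k0 p0 k0

  ifZeroP : PR 3
  ifZeroP = rec2 true p0 k0 p4 k0

  ifZ : ∀ {n} → PR n → PR n → PR n → PR n
  ifZ c x y = ifZeroP ⟨ c ∷ x ∷ y ∷ [] ⟩

  evRec-iterate : ∀ Z {n} (f₁ f₂ : PR n) g₁ g₂ xs (G : ℕ × ℕ → ℕ × ℕ) →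
                  (∀ k a b → (ev Z g₁ (k ∷ a ∷ b ∷ xs) , ev Z g₂ (k ∷ a ∷ b ∷ xs)) ≡ G (a , b)) →
                  ∀ k → evRec Z f₁ f₂ g₁ g₂ k xs ≡ iterate G k (ev Z f₁ xs , ev Z f₂ xs)
  evRec-iterate Z f₁ f₂ g₁ g₂ xs G h zero    = refl
  evRec-iterate Z f₁ f₂ g₁ g₂ xs G h (suc k) = trans (h k _ _) (cong G (evRec-iterate Z f₁ f₂ g₁ g₂ xs G h k))

  module _ (Z : Oracle) where
    predP-ev : ∀ y → ev Z predP (y ∷ []) ≡ pred y
    predP-ev zero    = refl
    predP-ev (suc y) = refl

    ifZeroP-ev : ∀ c x y → ev Z ifZeroP (c ∷ x ∷ y ∷ []) ≡ ifZero c x y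
    ifZeroP-ev zero    x y = refl
    ifZeroP-ev (suc c) x y = refl

  -- Opaque from here on: the evaluation lemmas below are applied by rewriting, and letting the
  -- type checker unfold Cantor pairing or these terms makes that infeasible.
  abstract
    pairᵒ : ℕ → ℕ → ℕ
    pairᵒ = pair

    pairᵒ≡pair : ∀ a b → pairᵒ a b ≡ pair a b
    pairᵒ≡pair a b = refl

    unpair-pairᵒ : ∀ a b → unpair (pairᵒ a b) ≡ (a , b)
    unpair-pairᵒ = unpair-pair

    pairᵒ-unpair : ∀ q → pairᵒ (proj₁ (unpair q)) (proj₂ (unpair q)) ≡ q
    pairᵒ-unpair = pair-unpair

    pairᵒ-injective : ∀ {a b c d} → pairᵒ a b ≡ pairᵒ c d → (a ≡ c) × (b ≡ d)
    pairᵒ-injective {a} {b} {c} {d} e = cong proj₁ same , cong proj₂ same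
      where
      same : (a , b) ≡ (c , d)
      same = trans (sym (unpair-pair a b)) (trans (cong unpair e) (unpair-pair c d))

    pairᵒ-≥ : ∀ a b → b ≤ pairᵒ a b
    pairᵒ-≥ a b = m≤n+m b (tri (a + b))

  -- lists of numbers are coded by 0 and cons
  cons : ℕ → ℕ → ℕ
  cons h t = suc (pairᵒ h t)

  lookupAL : ℕ → List (ℕ × ℕ) → ℕ
  lookupAL k [] = 0
  lookupAL k ((r , v) ∷ L) with k ≟ r
  ... | yes _ = v
  ... | no _  = lookupAL k L

  codeAL : List (ℕ × ℕ) → ℕ
  codeAL []            = 0
  codeAL ((k , v) ∷ L) = cons (pairᵒ k v) (codeAL L)

  length≤codeAL : ∀ L → length L ≤ codeAL L
  length≤codeAL []            = z≤n
  length≤codeAL ((k , v) ∷ L) = s≤s (≤-trans (length≤codeAL L) (pairᵒ-≥ (pairᵒ k v) (codeAL L)))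

  abstract
    addP subP distP pairP consP tailsP lookupP : PR 2
    fstP sndP headP tailP : PR 1
    addP    = rec2 true p0 k0 (S p1) k0
    subP    = rec2 true p0 k0 (predP ⟨ p1 ∷ [] ⟩) k0 ⟨ p1 ∷ p0 ∷ [] ⟩
    distP   = addP ⟨ subP ⟨ p0 ∷ p1 ∷ [] ⟩ ∷ subP ⟨ p1 ∷ p0 ∷ [] ⟩ ∷ [] ⟩
    pairP   = addP ⟨ rec2 true k0 k0 (addP ⟨ S p0 ∷ p1 ∷ [] ⟩) k0 ⟨ addP ⟨ p0 ∷ p1 ∷ [] ⟩ ∷ [] ⟩ ∷ p1 ∷ [] ⟩
    fstP    = rec2 true  k0 k0 (ifZ p1 (S p2) (predP ⟨ p1 ∷ [] ⟩)) (ifZ p1 k0 (S p2))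
    sndP    = rec2 false k0 k0 (ifZ p1 (S p2) (predP ⟨ p1 ∷ [] ⟩)) (ifZ p1 k0 (S p2))
    consP   = S (pairP ⟨ p0 ∷ p1 ∷ [] ⟩)
    headP   = fstP ⟨ predP ⟨ p0 ∷ [] ⟩ ∷ [] ⟩
    tailP   = sndP ⟨ predP ⟨ p0 ∷ [] ⟩ ∷ [] ⟩
    tailsP  = rec2 true p0 k0 (tailP ⟨ p1 ∷ [] ⟩) k0
    -- lookupP walks down the list (first component) until the key is found, then stores the value
    -- (second component) and empties the list
    lookupStep₁ lookupStep₂ : PR 5
    lookupStep₁ = ifZ p1 p1 (ifZ (distP ⟨ fstP ⟨ headP ⟨ p1 ∷ [] ⟩ ∷ [] ⟩ ∷ p3 ∷ [] ⟩) k0 (tailP ⟨ p1 ∷ [] ⟩))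
    lookupStep₂ = ifZ p1 p2 (ifZ (distP ⟨ fstP ⟨ headP ⟨ p1 ∷ [] ⟩ ∷ [] ⟩ ∷ p3 ∷ [] ⟩) (sndP ⟨ headP ⟨ p1 ∷ [] ⟩ ∷ [] ⟩) p2)
    lookupP = rec2 false p1 k0 lookupStep₁ lookupStep₂ ⟨ p1 ∷ p0 ∷ p1 ∷ [] ⟩

  module _ (Z : Oracle) where
    abstract
      addP-ev : ∀ a b → ev Z addP (a ∷ b ∷ []) ≡ a + b
      addP-ev zero    b = refl
      addP-ev (suc a) b = cong suc (addP-ev a b)

      subP-ev : ∀ a b → ev Z subP (a ∷ b ∷ []) ≡ a ∸ b
      subP-ev a zero    = refl
      subP-ev a (suc b) = trans (predP-ev Z (ev Z subP (a ∷ b ∷ []))) (trans (cong pred (subP-ev a b)) (pred[m∸n]≡m∸[1+n] a b))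

      distP-ev : ∀ a b → ev Z distP (a ∷ b ∷ []) ≡ ∣ a - b ∣
      distP-ev a b = trans (addP-ev (ev Z subP (a ∷ b ∷ [])) (ev Z subP (b ∷ a ∷ [])))
                           (trans (cong₂ _+_ (subP-ev a b) (subP-ev b a)) (∸+∸≡∣-∣ a b))

      pairP-ev : ∀ a b → ev Z pairP (a ∷ b ∷ []) ≡ pairᵒ a b
      pairP-ev a b = trans (addP-ev _ b) (cong (_+ b) (trans (cong (λ t → ev Z triP (t ∷ [])) (addP-ev a b)) (triP-ev (a + b))))
        where
        triP : PR 1
        triP = rec2 true k0 k0 (addP ⟨ S p0 ∷ p1 ∷ [] ⟩) k0
        triP-ev : ∀ a → ev Z triP (a ∷ []) ≡ tri a
        triP-ev zero    = refl
        triP-ev (suc a) = trans (addP-ev (suc a) _) (cong (suc a +_) (triP-ev a))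

      unpair-ev : ∀ k → evRec Z k0 k0 (ifZ p1 (S p2) (predP ⟨ p1 ∷ [] ⟩)) (ifZ p1 k0 (S p2)) k [] ≡ unpair k
      unpair-ev zero    = refl
      unpair-ev (suc k) rewrite unpair-ev k = advance (unpair k)
        where
        advance : ∀ p → (ev Z ifZeroP (proj₁ p ∷ suc (proj₂ p) ∷ ev Z predP (proj₁ p ∷ []) ∷ []) ,
                      ev Z ifZeroP (proj₁ p ∷ 0 ∷ suc (proj₂ p) ∷ [])) ≡ nextPair p
        advance (zero  , b) = refl
        advance (suc a , b) = refl

      fstP-ev : ∀ a b → ev Z fstP (pairᵒ a b ∷ []) ≡ a
      fstP-ev a b = trans (cong proj₁ (unpair-ev (pair a b))) (cong proj₁ (unpair-pair a b))

      sndP-ev : ∀ a b → ev Z sndP (pairᵒ a b ∷ []) ≡ b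
      sndP-ev a b = trans (cong proj₂ (unpair-ev (pair a b))) (cong proj₂ (unpair-pair a b))

      consP-ev : ∀ h t → ev Z consP (h ∷ t ∷ []) ≡ cons h t
      consP-ev h t = cong suc (pairP-ev h t)

      headP-ev : ∀ h t → ev Z headP (cons h t ∷ []) ≡ h
      headP-ev = fstP-ev

      tailP-ev : ∀ h t → ev Z tailP (cons h t ∷ []) ≡ t
      tailP-ev = sndP-ev

      tailP-0 : ev Z tailP (0 ∷ []) ≡ 0
      tailP-0 = refl

      tailsP-0 : ∀ l → ev Z tailsP (0 ∷ l ∷ []) ≡ l
      tailsP-0 l = refl

      tailsP-suc : ∀ k l → ev Z tailsP (suc k ∷ l ∷ []) ≡ ev Z tailP (ev Z tailsP (k ∷ l ∷ []) ∷ [])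
      tailsP-suc k l = refl

      lookupP-ev : ∀ k L → ev Z lookupP (k ∷ codeAL L ∷ []) ≡ lookupAL k L
      lookupP-ev k L = trans (cong proj₂ (evRec-iterate Z p1 k0 lookupStep₁ lookupStep₂ (k ∷ A ∷ []) scan (λ _ _ _ → refl) A))
                             (scan-iterate L A (length≤codeAL L))
        where
        A : ℕ
        A = codeAL L
        scan : ℕ × ℕ → ℕ × ℕ
        scan (a , b) = ev Z lookupStep₁ (0 ∷ a ∷ b ∷ k ∷ A ∷ []) , ev Z lookupStep₂ (0 ∷ a ∷ b ∷ k ∷ A ∷ [])
        scan-cons : ∀ k' v L r → scan (codeAL ((k' , v) ∷ L) , r) ≡ ifZero ∣ k' - k ∣ (0 , v) (codeAL L , r)
        scan-cons k' v L r
          rewrite fstP-ev (pairᵒ k' v) (codeAL L) | fstP-ev k' v | distP-ev k' k | sndP-ev (pairᵒ k' v) (codeAL L) | sndP-ev k' v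
          with ∣ k' - k ∣
        ... | zero  = refl
        ... | suc _ = refl
        scan-iterate : ∀ L m → length L ≤ m → proj₂ (iterate scan m (codeAL L , 0)) ≡ lookupAL k L
        scan-iterate [] m le = cong proj₂ (iterate-fixed scan (0 , 0) refl m)
        scan-iterate ((k' , v) ∷ L) (suc m) (s≤s le) =
          trans (cong proj₂ (trans (iterate-suc scan m _) (cong (iterate scan m) (scan-cons k' v L 0)))) found
          where
          found : proj₂ (iterate scan m (ifZero ∣ k' - k ∣ (0 , v) (codeAL L , 0))) ≡ lookupAL k ((k' , v) ∷ L)
          found with k ≟ k'
          ... | yes refl rewrite ∣n-n∣≡0 k = cong proj₂ (iterate-fixed scan (0 , v) refl m)
          ... | no k≢k' with ∣-∣≡suc k' k (≢-sym k≢k')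
          ... | _ , eq rewrite eq = scan-iterate L m le

module Simulation where
  open PrimitiveRecursive
  open ArithmeticPR
  open Execution

  codeInstr : Instr → ℕ
  codeInstr (inc r)   = pairᵒ 0 r
  codeInstr (dec r j) = pairᵒ 1 (pairᵒ r j)
  codeInstr (orc r)   = pairᵒ 2 r

  codeProg : Program → ℕ
  codeProg []      = 0
  codeProg (i ∷ P) = cons (codeInstr i) (codeProg P)

  nth≡head∘drop : ∀ P k → nth P k ≡ head (drop k P)
  nth≡head∘drop []      zero    = refl
  nth≡head∘drop []      (suc k) = refl
  nth≡head∘drop (i ∷ P) zero    = refl
  nth≡head∘drop (i ∷ P) (suc k) = nth≡head∘drop P k

  tailsP-codeProg : ∀ Z k P → ev Z tailsP (k ∷ codeProg P ∷ []) ≡ codeProg (drop k P)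
  tailsP-codeProg Z zero    P = tailsP-0 Z (codeProg P)
  tailsP-codeProg Z (suc k) P = begin
    ev Z tailsP (suc k ∷ codeProg P ∷ [])            ≡⟨ tailsP-suc Z k (codeProg P) ⟩
    ev Z tailP (ev Z tailsP (k ∷ codeProg P ∷ []) ∷ [])  ≡⟨ cong (λ t → ev Z tailP (t ∷ [])) (tailsP-codeProg Z k P) ⟩
    ev Z tailP (codeProg (drop k P) ∷ [])            ≡⟨ tail-codeProg (drop k P) ⟩
    codeProg (drop 1 (drop k P))                     ≡⟨ cong codeProg (trans (drop-drop k 1 P) (cong (λ m → drop m P) (+-comm k 1))) ⟩
    codeProg (drop (suc k) P)                        ∎
    where
    open ≡-Reasoning
    tail-codeProg : ∀ P → ev Z tailP (codeProg P ∷ []) ≡ codeProg (drop 1 P)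
    tail-codeProg []      = tailP-0 Z
    tail-codeProg (i ∷ P) = tailP-ev Z (codeInstr i) (codeProg P)

  -- The simulator takes a flag selecting the oracle: Z when nonzero, the empty oracle when zero.
  oracleFor : ℕ → Oracle → Oracle
  oracleFor zero    Z = ∅ₒ
  oracleFor (suc _) Z = Z

  stepAL : Oracle → Maybe Instr → ℕ → List (ℕ × ℕ) → ℕ × List (ℕ × ℕ)
  stepAL Z nothing          pc L = pc , L
  stepAL Z (just (inc r))   pc L = suc pc , (r , suc (lookupAL r L)) ∷ L
  stepAL Z (just (dec r j)) pc L with lookupAL r L
  ... | zero  = j , L
  ... | suc v = suc pc , (r , v) ∷ L
  stepAL Z (just (orc r))   pc L = suc pc , (r , bit (Z (lookupAL r L))) ∷ L

  stepProg : Program → Oracle → ℕ × List (ℕ × ℕ) → ℕ × List (ℕ × ℕ)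
  stepProg P Z (pc , L) = stepAL Z (head (drop pc P)) pc L

  encodeConfig : ℕ × List (ℕ × ℕ) → ℕ × ℕ
  encodeConfig (pc , L) = pc , codeAL L

  -- The step functions receive (counter, pc, registers, program, oracle flag, input).
  restP instrP tagP argP regP targetP argValP regValP : PR 6
  restP   = tailsP ⟨ p1 ∷ p3 ∷ [] ⟩
  instrP  = headP ⟨ restP ∷ [] ⟩
  tagP    = fstP ⟨ instrP ∷ [] ⟩
  argP    = sndP ⟨ instrP ∷ [] ⟩
  regP    = fstP ⟨ argP ∷ [] ⟩
  targetP = sndP ⟨ argP ∷ [] ⟩
  argValP = lookupP ⟨ argP ∷ p2 ∷ [] ⟩
  regValP = lookupP ⟨ regP ∷ p2 ∷ [] ⟩

  simStep₁ simStep₂ : PR 6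
  simStep₁ = ifZ restP p1 (ifZ tagP (S p1) (ifZ (predP ⟨ tagP ∷ [] ⟩) (ifZ regValP targetP (S p1)) (S p1)))
  simStep₂ = ifZ restP p2 (ifZ tagP (consP ⟨ pairP ⟨ argP ∷ S argValP ∷ [] ⟩ ∷ p2 ∷ [] ⟩)
               (ifZ (predP ⟨ tagP ∷ [] ⟩) (ifZ regValP p2 (consP ⟨ pairP ⟨ regP ∷ predP ⟨ regValP ∷ [] ⟩ ∷ [] ⟩ ∷ p2 ∷ [] ⟩))
                                          (consP ⟨ pairP ⟨ argP ∷ ifZ p4 k0 (query ⟨ argValP ∷ [] ⟩) ∷ [] ⟩ ∷ p2 ∷ [] ⟩)))

  simInit : PR 3
  simInit = consP ⟨ pairP ⟨ k0 ∷ p2 ∷ [] ⟩ ∷ k0 ∷ [] ⟩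

  -- arguments (steps, program, oracle flag, input)
  simPcP simRegsP : PR 4
  simPcP   = rec2 true  k0 simInit simStep₁ simStep₂
  simRegsP = rec2 false k0 simInit simStep₁ simStep₂

  oracle-flag : ∀ Z fl v → ev Z ifZeroP (fl ∷ 0 ∷ bit (Z v) ∷ []) ≡ bit (oracleFor fl Z v)
  oracle-flag Z zero    v = refl
  oracle-flag Z (suc _) v = refl

  module _ (Z : Oracle) (P : Program) (fl y : ℕ) where
    simStep : ℕ × ℕ → ℕ × ℕ
    simStep (a , b) = ev Z simStep₁ (0 ∷ a ∷ b ∷ codeProg P ∷ fl ∷ y ∷ []) ,
                      ev Z simStep₂ (0 ∷ a ∷ b ∷ codeProg P ∷ fl ∷ y ∷ [])

    simStep-correct : ∀ pc L → simStep (pc , codeAL L) ≡ encodeConfig (stepProg P (oracleFor fl Z) (pc , L))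
    simStep-correct pc L rewrite tailsP-codeProg Z pc P with drop pc P
    ... | [] = refl
    ... | inc r ∷ rest
      rewrite headP-ev Z (codeInstr (inc r)) (codeProg rest) | fstP-ev Z 0 r | sndP-ev Z 0 r | lookupP-ev Z r L
            | pairP-ev Z r (suc (lookupAL r L)) | consP-ev Z (pairᵒ r (suc (lookupAL r L))) (codeAL L) = refl
    ... | dec r j ∷ rest
      rewrite headP-ev Z (codeInstr (dec r j)) (codeProg rest) | fstP-ev Z 1 (pairᵒ r j) | sndP-ev Z 1 (pairᵒ r j)
            | fstP-ev Z r j | sndP-ev Z r j | lookupP-ev Z r L with lookupAL r L
    ... | zero = refl
    ... | suc v rewrite pairP-ev Z r v | consP-ev Z (pairᵒ r v) (codeAL L) = refl
    simStep-correct pc L | orc r ∷ rest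
      rewrite headP-ev Z (codeInstr (orc r)) (codeProg rest) | fstP-ev Z 2 r | sndP-ev Z 2 r | lookupP-ev Z r L
            | oracle-flag Z fl (lookupAL r L)
            | pairP-ev Z r (bit (oracleFor fl Z (lookupAL r L))) | consP-ev Z (pairᵒ r (bit (oracleFor fl Z (lookupAL r L)))) (codeAL L)
      = refl

    simulate-correct : ∀ s → evRec Z k0 simInit simStep₁ simStep₂ s (codeProg P ∷ fl ∷ y ∷ []) ≡
                             encodeConfig (iterate (stepProg P (oracleFor fl Z)) s (0 , (0 , y) ∷ []))
    simulate-correct s = trans (evRec-iterate Z k0 simInit simStep₁ simStep₂ (codeProg P ∷ fl ∷ y ∷ []) simStep (λ _ _ _ → refl) s)
                               (trans (cong (iterate simStep s) init) (iterate-encode s _))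
      where
      init : (0 , ev Z simInit (codeProg P ∷ fl ∷ y ∷ [])) ≡ encodeConfig (0 , (0 , y) ∷ [])
      init rewrite pairP-ev Z 0 y | consP-ev Z (pairᵒ 0 y) 0 = refl
      iterate-encode : ∀ k x → iterate simStep k (encodeConfig x) ≡ encodeConfig (iterate (stepProg P (oracleFor fl Z)) k x)
      iterate-encode zero    x = refl
      iterate-encode (suc k) x = trans (cong simStep (iterate-encode k x)) (simStep-correct _ _)

  Agree : Regs → List (ℕ × ℕ) → Set
  Agree ρ L = ∀ k → ρ k ≡ lookupAL k L

  Agree-set : ∀ {ρ L} r {v v'} → Agree ρ L → v ≡ v' → Agree (set ρ r v) ((r , v') ∷ L)
  Agree-set r h e k with k ≟ r
  ... | yes _ = e
  ... | no _  = h k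

  step-agree : ∀ Z i pc L ρ → Agree ρ L →
               proj₁ (step Z i pc ρ) ≡ proj₁ (stepAL Z (just i) pc L) × Agree (proj₂ (step Z i pc ρ)) (proj₂ (stepAL Z (just i) pc L))
  step-agree Z (inc r)   pc L ρ h = refl , Agree-set r h (cong suc (h r))
  step-agree Z (orc r)   pc L ρ h = refl , Agree-set r h (cong (λ t → bit (Z t)) (h r))
  step-agree Z (dec r j) pc L ρ h = by-value (ρ r) (lookupAL r L) (h r) refl refl
    where
    by-value : ∀ a b → a ≡ b → ρ r ≡ a → lookupAL r L ≡ b →
               proj₁ (step Z (dec r j) pc ρ) ≡ proj₁ (stepAL Z (just (dec r j)) pc L) ×
               Agree (proj₂ (step Z (dec r j) pc ρ)) (proj₂ (stepAL Z (just (dec r j)) pc L))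
    by-value zero    .zero    refl e₁ e₂ rewrite e₁ | e₂ = refl , h
    by-value (suc v) .(suc v) refl e₁ e₂ rewrite e₁ | e₂ = refl , Agree-set r h refl

  data Matches (P : Program) : Maybe Regs → ℕ × List (ℕ × ℕ) → Set where
    halted  : ∀ {ρ pc L} → head (drop pc P) ≡ nothing → Agree ρ L → Matches P (just ρ) (pc , L)
    running : ∀ {pc L i} → head (drop pc P) ≡ just i → Matches P nothing (pc , L)

  run-matches : ∀ P Z f pc L ρ → Agree ρ L → Matches P (run P Z f pc ρ) (iterate (stepProg P Z) f (pc , L))
  run-matches P Z f pc L ρ h = by-instruction (nth P pc) refl f
    where
    by-instruction : ∀ m → nth P pc ≡ m → ∀ f → Matches P (run P Z f pc ρ) (iterate (stepProg P Z) f (pc , L))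
    by-instruction nothing e f
      rewrite run-halted P Z f pc ρ e
            | iterate-fixed (stepProg P Z) (pc , L) (cong (λ t → stepAL Z t pc L) (trans (sym (nth≡head∘drop P pc)) e)) f
      = halted (trans (sym (nth≡head∘drop P pc)) e) h
    by-instruction (just i) e zero rewrite run-out-of-fuel P Z pc ρ i e = running (trans (sym (nth≡head∘drop P pc)) e)
    by-instruction (just i) e (suc f) with step-agree Z i pc L ρ h
    ... | same-pc , agree
      rewrite run-step P Z f pc ρ i e | same-pc
            | iterate-suc (stepProg P Z) f (pc , L) | sym (nth≡head∘drop P pc) | e
      = run-matches P Z f _ _ _ agree

  -- remaining Z e fl y s is the code of the program from the pc the machine coded by e reaches after
  -- s steps on input y; it is 0 iff the machine has halted by then.
  remaining : Oracle → ℕ → ℕ → ℕ → ℕ → ℕ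
  remaining Z e fl y s = ev Z tailsP (ev Z simPcP (s ∷ e ∷ fl ∷ y ∷ []) ∷ e ∷ [])

  output : Oracle → ℕ → ℕ → ℕ → ℕ → ℕ
  output Z e fl y s = ev Z lookupP (0 ∷ ev Z simRegsP (s ∷ e ∷ fl ∷ y ∷ []) ∷ [])

  remaining-mono : ∀ Z e fl y s d → remaining Z e fl y s ≡ 0 → remaining Z e fl y (d + s) ≡ 0
  remaining-mono Z e fl y s zero    h = h
  remaining-mono Z e fl y s (suc d) h = trans (cong (λ t → ev Z tailsP (t ∷ e ∷ [])) stays) h'
    where
    h' : remaining Z e fl y (d + s) ≡ 0
    h' = remaining-mono Z e fl y s d h
    c : ℕ × ℕ
    c = evRec Z k0 simInit simStep₁ simStep₂ (d + s) (e ∷ fl ∷ y ∷ [])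
    stays : ev Z simStep₁ (d + s ∷ proj₁ c ∷ proj₂ c ∷ e ∷ fl ∷ y ∷ []) ≡ proj₁ c
    stays rewrite h' = refl

  module _ (Z : Oracle) (P : Program) (fl y s : ℕ) where
    private
      c : ℕ × List (ℕ × ℕ)
      c = iterate (stepProg P (oracleFor fl Z)) s (0 , (0 , y) ∷ [])
      remaining≡ : remaining Z (codeProg P) fl y s ≡ codeProg (drop (proj₁ c) P)
      remaining≡ = trans (cong (λ t → ev Z tailsP (proj₁ t ∷ codeProg P ∷ [])) (simulate-correct Z P fl y s))
                         (tailsP-codeProg Z (proj₁ c) P)
      output≡ : output Z (codeProg P) fl y s ≡ lookupAL 0 (proj₂ c)
      output≡ = trans (cong (λ t → ev Z lookupP (0 ∷ proj₂ t ∷ [])) (simulate-correct Z P fl y s)) (lookupP-ev Z 0 (proj₂ c))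
      agree₀ : Agree (input y) ((0 , y) ∷ [])
      agree₀ zero    = refl
      agree₀ (suc k) = refl
      halted-code : ∀ l → head l ≡ nothing → codeProg l ≡ 0
      halted-code [] e = refl
      running-code : ∀ l i → head l ≡ just i → codeProg l ≢ 0
      running-code (_ ∷ _) i e ()

    remaining≡0⇒run : remaining Z (codeProg P) fl y s ≡ 0 →
                      ∃[ a ] (run P (oracleFor fl Z) s 0 (input y) ≡ just a × a 0 ≡ output Z (codeProg P) fl y s)
    remaining≡0⇒run h with run P (oracleFor fl Z) s 0 (input y) | run-matches P (oracleFor fl Z) s 0 _ _ agree₀
    ... | just a  | halted _ ag = a , refl , trans (ag 0) (sym output≡)
    ... | nothing | running {i = i} e = ⊥-elim (running-code _ i e (trans (sym remaining≡) h))

    run⇒remaining≡0 : ∀ a → run P (oracleFor fl Z) s 0 (input y) ≡ just a →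
                      remaining Z (codeProg P) fl y s ≡ 0 × a 0 ≡ output Z (codeProg P) fl y s
    run⇒remaining≡0 a r with run P (oracleFor fl Z) s 0 (input y) | run-matches P (oracleFor fl Z) s 0 _ _ agree₀
    run⇒remaining≡0 a refl | just .a | halted e ag = trans remaining≡ (halted-code _ e) , trans (ag 0) (sym output≡)

module StringCodes where
  open PrimitiveRecursive
  open ArithmeticPR

  codeStrᵒ : Str → ℕ
  codeStrᵒ []      = 0
  codeStrᵒ (b ∷ s) = cons (bit b) (codeStrᵒ s)

  codeStrᵒ≡codeStr : ∀ τ → codeStrᵒ τ ≡ codeStr τ
  codeStrᵒ≡codeStr []      = refl
  codeStrᵒ≡codeStr (b ∷ s) = cong suc (trans (pairᵒ≡pair (bit b) (codeStrᵒ s)) (cong (pair (bit b)) (codeStrᵒ≡codeStr s)))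

  length≤codeStrᵒ : ∀ τ → length τ ≤ codeStrᵒ τ
  length≤codeStrᵒ []      = z≤n
  length≤codeStrᵒ (b ∷ τ) = s≤s (≤-trans (length≤codeStrᵒ τ) (pairᵒ-≥ (bit b) (codeStrᵒ τ)))

  -- decodeStr m c reads at most m bits off the list coded by c.
  decodeStr : ℕ → ℕ → Str
  decodeStr zero    c       = []
  decodeStr (suc m) zero    = []
  decodeStr (suc m) (suc q) with proj₁ (unpair q)
  ... | zero  = false ∷ decodeStr m (proj₂ (unpair q))
  ... | suc _ = true  ∷ decodeStr m (proj₂ (unpair q))

  decodeStr-codeStrᵒ : ∀ τ m → length τ ≤ m → decodeStr m (codeStrᵒ τ) ≡ τ
  decodeStr-codeStrᵒ []          zero    le      = refl
  decodeStr-codeStrᵒ []          (suc m) le      = refl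
  decodeStr-codeStrᵒ (true ∷ τ)  (suc m) (s≤s le) rewrite unpair-pairᵒ 1 (codeStrᵒ τ) =
    cong (true ∷_) (trans (cong (λ p → decodeStr m (proj₂ p)) (unpair-pairᵒ 1 (codeStrᵒ τ))) (decodeStr-codeStrᵒ τ m le))
  decodeStr-codeStrᵒ (false ∷ τ) (suc m) (s≤s le) rewrite unpair-pairᵒ 0 (codeStrᵒ τ) =
    cong (false ∷_) (trans (cong (λ p → decodeStr m (proj₂ p)) (unpair-pairᵒ 0 (codeStrᵒ τ))) (decodeStr-codeStrᵒ τ m le))

  -- validStrP c is 0 iff c codes a list of bits: the loop walks down the list, and the second
  -- component becomes 1 at an entry other than 0 or 1.
  validStep₁ validStep₂ : PR 4
  validStep₁ = ifZ p1 p1 (ifZ (predP ⟨ headP ⟨ p1 ∷ [] ⟩ ∷ [] ⟩) (tailP ⟨ p1 ∷ [] ⟩) k0)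
  validStep₂ = ifZ p1 p2 (ifZ (predP ⟨ headP ⟨ p1 ∷ [] ⟩ ∷ [] ⟩) p2 (const 1))

  validStrP : PR 1
  validStrP = rec2 false p0 k0 validStep₁ validStep₂ ⟨ p0 ∷ p0 ∷ [] ⟩

  module _ (Z : Oracle) where
    private
      scan : ℕ × ℕ → ℕ × ℕ
      scan (a , b) = ev Z validStep₁ (0 ∷ a ∷ b ∷ 0 ∷ []) , ev Z validStep₂ (0 ∷ a ∷ b ∷ 0 ∷ [])

      scan-bit : ∀ b t r → scan (cons (bit b) t , r) ≡ (t , r)
      scan-bit b t r rewrite headP-ev Z (bit b) t | tailP-ev Z (bit b) t with b
      ... | true  = refl
      ... | false = refl

      scan-invalid : ∀ h t r → scan (cons (suc (suc h)) t , r) ≡ (0 , 1)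
      scan-invalid h t r rewrite headP-ev Z (suc (suc h)) t = refl

      scan-codeStrᵒ : ∀ τ m → length τ ≤ m → proj₂ (iterate scan m (codeStrᵒ τ , 0)) ≡ 0
      scan-codeStrᵒ []      m       le      = cong proj₂ (iterate-fixed scan (0 , 0) refl m)
      scan-codeStrᵒ (b ∷ τ) (suc m) (s≤s le) =
        trans (cong proj₂ (trans (iterate-suc scan m _) (cong (iterate scan m) (scan-bit b (codeStrᵒ τ) 0)))) (scan-codeStrᵒ τ m le)

      scan-decode : ∀ m c → c ≤ m → proj₂ (iterate scan m (c , 0)) ≡ 0 → codeStrᵒ (decodeStr m c) ≡ c
      scan-decode zero    zero    le e = refl
      scan-decode (suc m) zero    le e = refl
      scan-decode (suc m) (suc q) (s≤s le) e with proj₁ (unpair q) | pairᵒ-unpair q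
      ... | zero | eq = cong suc (trans (cong (pairᵒ 0) (scan-decode m t t≤m e′)) eq)
        where
        t = proj₂ (unpair q)
        t≤m : t ≤ m
        t≤m = ≤-trans (pairᵒ-≥ 0 t) (subst (_≤ m) (sym eq) le)
        e′ : proj₂ (iterate scan m (t , 0)) ≡ 0
        e′ = trans (sym (cong proj₂ (trans (iterate-suc scan m _) (cong (iterate scan m) (scan-bit false t 0)))))
                   (subst (λ x → proj₂ (iterate scan (suc m) (suc x , 0)) ≡ 0) (sym eq) e)
      ... | suc zero | eq = cong suc (trans (cong (pairᵒ 1) (scan-decode m t t≤m e′)) eq)
        where
        t = proj₂ (unpair q)
        t≤m : t ≤ m
        t≤m = ≤-trans (pairᵒ-≥ 1 t) (subst (_≤ m) (sym eq) le)
        e′ : proj₂ (iterate scan m (t , 0)) ≡ 0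
        e′ = trans (sym (cong proj₂ (trans (iterate-suc scan m _) (cong (iterate scan m) (scan-bit true t 0)))))
                   (subst (λ x → proj₂ (iterate scan (suc m) (suc x , 0)) ≡ 0) (sym eq) e)
      ... | suc (suc h) | eq with () ← trans (sym (cong proj₂ (trans (iterate-suc scan m _)
                                        (trans (cong (iterate scan m) (scan-invalid h (proj₂ (unpair q)) 0))
                                               (iterate-fixed scan (0 , 1) refl m)))))
                                     (subst (λ x → proj₂ (iterate scan (suc m) (suc x , 0)) ≡ 0) (sym eq) e)

      validStrP-scan : ∀ c → ev Z validStrP (c ∷ []) ≡ proj₂ (iterate scan c (c , 0))
      validStrP-scan c = cong proj₂ (evRec-iterate Z p0 k0 validStep₁ validStep₂ (c ∷ []) scan (λ _ _ _ → refl) c)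

    validStrP-codeStrᵒ : ∀ τ → ev Z validStrP (codeStrᵒ τ ∷ []) ≡ 0
    validStrP-codeStrᵒ τ = trans (validStrP-scan (codeStrᵒ τ)) (scan-codeStrᵒ τ (codeStrᵒ τ) (length≤codeStrᵒ τ))

    validStrP-decode : ∀ c → ev Z validStrP (c ∷ []) ≡ 0 → codeStrᵒ (decodeStr c c) ≡ c
    validStrP-decode c e = scan-decode c c ≤-refl (trans (sym (validStrP-scan c)) e)

module Enumeration where
  open PrimitiveRecursive
  open ArithmeticPR
  open StringCodes
  open Simulation

  codePairᵒ : Pair → ℕ
  codePairᵒ (τ , σ) = pairᵒ (codeStrᵒ τ) (codeStrᵒ σ)

  codePairᵒ≡codePair : ∀ x → codePairᵒ x ≡ codePair x
  codePairᵒ≡codePair (τ , σ) = trans (pairᵒ≡pair _ _) (cong₂ pair (codeStrᵒ≡codeStr τ) (codeStrᵒ≡codeStr σ))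

  decodePair : ℕ → Pair
  decodePair n = decodeStr (proj₁ (unpair n)) (proj₁ (unpair n)) , decodeStr (proj₂ (unpair n)) (proj₂ (unpair n))

  decodePair-codePairᵒ : ∀ x → decodePair (codePairᵒ x) ≡ x
  decodePair-codePairᵒ (τ , σ) = cong₂ _,_
    (trans (cong (λ p → decodeStr (proj₁ p) (proj₁ p)) (unpair-pairᵒ (codeStrᵒ τ) (codeStrᵒ σ)))
           (decodeStr-codeStrᵒ τ _ (length≤codeStrᵒ τ)))
    (trans (cong (λ p → decodeStr (proj₂ p) (proj₂ p)) (unpair-pairᵒ (codeStrᵒ τ) (codeStrᵒ σ)))
           (decodeStr-codeStrᵒ σ _ (length≤codeStrᵒ σ)))

  validPairP : PR 1
  validPairP = addP ⟨ validStrP ⟨ fstP ⟨ p0 ∷ [] ⟩ ∷ [] ⟩ ∷ validStrP ⟨ sndP ⟨ p0 ∷ [] ⟩ ∷ [] ⟩ ∷ [] ⟩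

  module _ (Z : Oracle) where
    validPairP-codePairᵒ : ∀ x → ev Z validPairP (codePairᵒ x ∷ []) ≡ 0
    validPairP-codePairᵒ (τ , σ)
      rewrite fstP-ev Z (codeStrᵒ τ) (codeStrᵒ σ) | sndP-ev Z (codeStrᵒ τ) (codeStrᵒ σ)
            | validStrP-codeStrᵒ Z τ | validStrP-codeStrᵒ Z σ | addP-ev Z 0 0 = refl

    validPairP-decode : ∀ n → ev Z validPairP (n ∷ []) ≡ 0 → codePairᵒ (decodePair n) ≡ n
    validPairP-decode n e = trans (cong₂ pairᵒ (validStrP-decode Z f e₁) (validStrP-decode Z g e₂)) (pairᵒ-unpair n)
      where
      f g : ℕ
      f = proj₁ (unpair n)
      g = proj₂ (unpair n)
      e′ : ev Z validStrP (f ∷ []) + ev Z validStrP (g ∷ []) ≡ 0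
      e′ = trans (sym (trans (cong (λ m → ev Z validPairP (m ∷ [])) (sym (pairᵒ-unpair n)))
                      (trans (cong₂ (λ a b → ev Z addP (ev Z validStrP (a ∷ []) ∷ ev Z validStrP (b ∷ []) ∷ []))
                                    (fstP-ev Z f g) (sndP-ev Z f g))
                             (addP-ev Z _ _)))) e
      e₁ : ev Z validStrP (f ∷ []) ≡ 0
      e₁ = m+n≡0⇒m≡0 _ e′
      e₂ : ev Z validStrP (g ∷ []) ≡ 0
      e₂ = m+n≡0⇒n≡0 _ e′

  -- enumTest Z e s k is 0 iff k codes a pair on which the machine coded by e halts within s steps.
  enumTest : Oracle → ℕ → ℕ → ℕ → ℕ
  enumTest Z e s k = ev Z validPairP (k ∷ []) + remaining Z e 1 k s

  enumCodes : Oracle → ℕ → ℕ → ℕ → List ℕ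
  enumCodes Z e s zero = []
  enumCodes Z e s (suc k) with enumTest Z e s k
  ... | zero  = k ∷ enumCodes Z e s k
  ... | suc _ = enumCodes Z e s k

  -- the paper's finite approximation: the pairs with code below s enumerated within s steps
  enumerated : Oracle → ℕ → ℕ → List Pair
  enumerated Z e s = map decodePair (enumCodes Z e s s)

  codeNums : List ℕ → ℕ
  codeNums []      = 0
  codeNums (k ∷ l) = cons k (codeNums l)

  -- arguments of enumStep: (k, list so far, unused, e, s)
  enumStep : PR 5
  enumStep = ifZ (addP ⟨ validPairP ⟨ p0 ∷ [] ⟩ ∷ tailsP ⟨ simPcP ⟨ p4 ∷ p3 ∷ const 1 ∷ p0 ∷ [] ⟩ ∷ p3 ∷ [] ⟩ ∷ [] ⟩)
                 (consP ⟨ p0 ∷ p1 ∷ [] ⟩) p1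

  enumP : PR 2
  enumP = rec2 true k0 k0 enumStep k0 ⟨ p1 ∷ p0 ∷ p1 ∷ [] ⟩

  module _ (Z : Oracle) (e s : ℕ) where
    enumP-ev : ev Z enumP (e ∷ s ∷ []) ≡ codeNums (enumCodes Z e s s)
    enumP-ev = go s
      where
      go : ∀ k → proj₁ (evRec Z k0 k0 enumStep k0 k (e ∷ s ∷ [])) ≡ codeNums (enumCodes Z e s k)
      go zero = refl
      go (suc k) rewrite addP-ev Z (ev Z validPairP (k ∷ [])) (remaining Z e 1 k s) | go k with enumTest Z e s k
      ... | zero  = consP-ev Z k (codeNums (enumCodes Z e s k))
      ... | suc _ = refl

    enumCodes-∈⁻ : ∀ k y → y ∈ enumCodes Z e s k → y < k × enumTest Z e s y ≡ 0
    enumCodes-∈⁻ (suc k) y m with enumTest Z e s k in eq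
    enumCodes-∈⁻ (suc k) y (here refl) | zero = n<1+n k , eq
    enumCodes-∈⁻ (suc k) y (there m)   | zero with enumCodes-∈⁻ k y m
    ... | l , t = m<n⇒m<1+n l , t
    enumCodes-∈⁻ (suc k) y m | suc _ with enumCodes-∈⁻ k y m
    ... | l , t = m<n⇒m<1+n l , t

    enumCodes-∈⁺ : ∀ k y → y < k → enumTest Z e s y ≡ 0 → y ∈ enumCodes Z e s k
    enumCodes-∈⁺ (suc k) y l t with enumTest Z e s k in eq
    ... | zero with y ≟ k
    ...   | yes refl = here refl
    ...   | no y≢k   = there (enumCodes-∈⁺ k y (≤∧≢⇒< (≤-pred l) y≢k) t)
    enumCodes-∈⁺ (suc k) y l t | suc _ with y ≟ k
    ...   | yes refl = ⊥-elim (0≢1+n (trans (sym t) eq))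
    ...   | no y≢k   = enumCodes-∈⁺ k y (≤∧≢⇒< (≤-pred l) y≢k) t

  codeList-enumerated : ∀ Z e s → codeList (enumerated Z e s) ≡ ev Z enumP (e ∷ s ∷ [])
  codeList-enumerated Z e s = trans (go (enumCodes Z e s s) (λ y m → proj₂ (enumCodes-∈⁻ Z e s s y m))) (sym (enumP-ev Z e s))
    where
    go : ∀ ns → (∀ y → y ∈ ns → enumTest Z e s y ≡ 0) → codeList (map decodePair ns) ≡ codeNums ns
    go []       h = refl
    go (n ∷ ns) h = cong suc (trans (cong₂ pair (trans (sym (codePairᵒ≡codePair (decodePair n)))
                                                       (validPairP-decode Z n (m+n≡0⇒m≡0 _ (h n (here refl)))))
                                                (go ns (λ y m → h y (there m))))
                                    (sym (pairᵒ≡pair n (codeNums ns))))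

  enumerated-mono : ∀ Z e {s s' x} → s ≤ s' → x ∈ enumerated Z e s → x ∈ enumerated Z e s'
  enumerated-mono Z e {s} {s'} s≤s' m with ∈-map⁻ decodePair m
  ... | n , mn , refl with enumCodes-∈⁻ Z e s s n mn
  ... | l , t = ∈-map⁺ decodePair (enumCodes-∈⁺ Z e s' s' n (≤-trans l s≤s')
                  (subst (λ s'' → enumTest Z e s'' n ≡ 0) (m∸n+n≡m s≤s')
                         (cong₂ _+_ (m+n≡0⇒m≡0 _ t) (remaining-mono Z e 1 n s (s' ∸ s) (m+n≡0⇒n≡0 _ t)))))

  enumerated-∋ : ∀ Z e s x → codePairᵒ x < s → remaining Z e 1 (codePairᵒ x) s ≡ 0 → x ∈ enumerated Z e s
  enumerated-∋ Z e s x l h = subst (_∈ enumerated Z e s) (decodePair-codePairᵒ x)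
    (∈-map⁺ decodePair (enumCodes-∈⁺ Z e s s (codePairᵒ x) l (cong₂ _+_ (validPairP-codePairᵒ Z x) h)))

  enumerated-∈ : ∀ Z e s {x} → x ∈ enumerated Z e s → ∃[ n ] (x ≡ decodePair n × enumTest Z e s n ≡ 0)
  enumerated-∈ Z e s m with ∈-map⁻ decodePair m
  ... | n , mn , refl = n , refl , proj₂ (enumCodes-∈⁻ Z e s s n mn)

open PrimitiveRecursive using (PR; const; rec2; ev)
open ArithmeticPR
open Simulation
open StringCodes
open Enumeration

strip : Bool → List Pair → List Pair
strip b [] = []
strip b (([] , σ) ∷ l) = strip b l
strip b ((c ∷ τ , σ) ∷ l) with c Bool.≟ b
... | yes _ = (τ , σ) ∷ strip b l
... | no _  = strip b l

strip-∈⁻ : ∀ b l {τ σ} → (τ , σ) ∈ strip b l → (b ∷ τ , σ) ∈ l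
strip-∈⁻ b (([] , σ') ∷ l) m = there (strip-∈⁻ b l m)
strip-∈⁻ b ((c ∷ τ' , σ') ∷ l) m with c Bool.≟ b
strip-∈⁻ b ((c ∷ τ' , σ') ∷ l) (here refl) | yes refl = here refl
strip-∈⁻ b ((c ∷ τ' , σ') ∷ l) (there m)   | yes _    = there (strip-∈⁻ b l m)
strip-∈⁻ b ((c ∷ τ' , σ') ∷ l) m           | no _     = there (strip-∈⁻ b l m)

strip-∈⁺ : ∀ b l {τ σ} → (b ∷ τ , σ) ∈ l → (τ , σ) ∈ strip b l
strip-∈⁺ b (([] , σ') ∷ l) (there m) = strip-∈⁺ b l m
strip-∈⁺ b ((c ∷ τ' , σ') ∷ l) m with c Bool.≟ b
strip-∈⁺ b ((c ∷ τ' , σ') ∷ l) (here refl) | yes _  = here refl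
strip-∈⁺ b ((c ∷ τ' , σ') ∷ l) (there m)   | yes _  = there (strip-∈⁺ b l m)
strip-∈⁺ b ((c ∷ τ' , σ') ∷ l) (here refl) | no b≢b = ⊥-elim (b≢b refl)
strip-∈⁺ b ((c ∷ τ' , σ') ∷ l) (there m)   | no _   = strip-∈⁺ b l m

∈-prefix : ∀ b l {τ σ} → (τ , σ) ∈ l → (b ∷ τ , σ) ∈ prefix b l
∈-prefix b (x ∷ l) (here refl) = here refl
∈-prefix b (x ∷ l) (there m)   = there (∈-prefix b l m)

⊆-join-strip : ∀ l → ListAll.All (λ x → proj₁ x ≢ []) l → l ⊆ₗ join (strip false l) (strip true l)
⊆-join-strip l ne {[] , σ} m = ⊥-elim (ListAll.lookup ne m refl)
⊆-join-strip l ne {false ∷ τ , σ} m = ∈-++⁺ˡ (∈-prefix false (strip false l) (strip-∈⁺ false l m))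
⊆-join-strip l ne {true ∷ τ , σ} m = ∈-++⁺ʳ (prefix false (strip false l)) (∈-prefix true (strip true l) (strip-∈⁺ true l m))

totalLength : List Pair → ℕ
totalLength []      = 0
totalLength (x ∷ l) = length (proj₁ x) + totalLength l

length≤totalLength : ∀ l {x} → x ∈ l → length (proj₁ x) ≤ totalLength l
length≤totalLength (y ∷ l) (here refl) = m≤m+n _ _
length≤totalLength (y ∷ l) (there m)   = ≤-trans (length≤totalLength l m) (m≤n+m _ _)

tagged : ℕ → Str → Str
tagged e τ = replicate e true ++ false ∷ τ

tagged-injective : ∀ k e τ τ' → tagged k τ ≡ tagged e τ' → k ≡ e × τ ≡ τ'
tagged-injective zero    zero    τ τ' refl = refl , refl
tagged-injective (suc k) (suc e) τ τ' eq with tagged-injective k e τ τ' (cong (λ { [] → [] ; (_ ∷ l) → l }) eq)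
... | refl , τ≡τ' = refl , τ≡τ'

ones≢tagged : ∀ k e τ → replicate k true ++ [] ≢ tagged e τ
ones≢tagged zero    zero    τ ()
ones≢tagged zero    (suc e) τ ()
ones≢tagged (suc k) zero    τ ()
ones≢tagged (suc k) (suc e) τ eq = ones≢tagged k e τ (cong (λ { [] → [] ; (_ ∷ l) → l }) eq)

ones-∷ʳ : ∀ k τ → replicate k true ++ true ∷ τ ≡ true ∷ (replicate k true ++ τ)
ones-∷ʳ zero    τ = refl
ones-∷ʳ (suc k) τ = cong (true ∷_) (ones-∷ʳ k τ)

length-tagged : ∀ e τ → length (tagged e τ) ≡ e + suc (length τ)
length-tagged e τ = trans (length-++ (replicate e true)) (cong (_+ suc (length τ)) (length-replicate e))

taggedCode : ℕ → ℕ → ℕ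
taggedCode zero    c = cons 0 c
taggedCode (suc e) c = cons 1 (taggedCode e c)

taggedCodeP : PR 2
taggedCodeP = rec2 true (consP ⟨ k0 ∷ p0 ∷ [] ⟩) k0 (consP ⟨ const 1 ∷ p1 ∷ [] ⟩) k0

taggedCodeP-ev : ∀ Z e c → ev Z taggedCodeP (e ∷ c ∷ []) ≡ taggedCode e c
taggedCodeP-ev Z zero    c = consP-ev Z 0 c
taggedCodeP-ev Z (suc e) c = trans (consP-ev Z 1 _) (cong (cons 1) (taggedCodeP-ev Z e c))

taggedCode-codeStrᵒ : ∀ e τ → taggedCode e (codeStrᵒ τ) ≡ codeStrᵒ (tagged e τ)
taggedCode-codeStrᵒ zero    τ = refl
taggedCode-codeStrᵒ (suc e) τ = cong (cons 1) (taggedCode-codeStrᵒ e τ)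

codeStrᵒ-taggedCode : ∀ e c τ' → codeStrᵒ τ' ≡ taggedCode e c → ∃[ τ ] (τ' ≡ tagged e τ × codeStrᵒ τ ≡ c)
codeStrᵒ-taggedCode zero    c []       ()
codeStrᵒ-taggedCode (suc e) c []       ()
codeStrᵒ-taggedCode zero    c (b ∷ τ₁) eq with pairᵒ-injective (suc-injective eq)
codeStrᵒ-taggedCode zero    c (false ∷ τ₁) eq | _ , e₂ = τ₁ , refl , e₂
codeStrᵒ-taggedCode zero    c (true ∷ τ₁)  eq | () , _
codeStrᵒ-taggedCode (suc e) c (b ∷ τ₁) eq with pairᵒ-injective (suc-injective eq)
codeStrᵒ-taggedCode (suc e) c (false ∷ τ₁) eq | () , _
codeStrᵒ-taggedCode (suc e) c (true ∷ τ₁)  eq | _ , e₂ with codeStrᵒ-taggedCode e c τ₁ e₂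
... | τ , refl , eτ = τ , refl , eτ

-- The searcher of this checker halts on the code n of (τ', σ) iff some witness
-- ⟨e, ⌜τ⌝, ⌜σ⌝, s, t⟩ has τ' = 1^e 0 τ, ⌜(τ, σ)⌝ < s, the machine e with oracle Z halting on
-- (τ, σ) within s steps, and the decider r₀ accepting the set enumerated so far within t steps.
module Checker (r₀ : ℕ) where
  witness : ℕ → ℕ → ℕ → ℕ → ℕ → ℕ
  witness e cτ cσ s t = pairᵒ e (pairᵒ cτ (pairᵒ cσ (pairᵒ s t)))

  witness-surjective : ∀ w → ∃[ e ] ∃[ cτ ] ∃[ cσ ] ∃[ s ] ∃[ t ] (witness e cτ cσ s t ≡ w)
  witness-surjective w = e , cτ , cσ , s , t ,
    trans (cong (pairᵒ e) (trans (cong (pairᵒ cτ) (trans (cong (pairᵒ cσ) (pairᵒ-unpair w₃)) (pairᵒ-unpair w₂))) (pairᵒ-unpair w₁)))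
          (pairᵒ-unpair w)
    where
    e w₁ cτ w₂ cσ w₃ s t : ℕ
    e  = proj₁ (unpair w)
    w₁ = proj₂ (unpair w)
    cτ = proj₁ (unpair w₁)
    w₂ = proj₂ (unpair w₁)
    cσ = proj₁ (unpair w₂)
    w₃ = proj₂ (unpair w₂)
    s  = proj₁ (unpair w₃)
    t  = proj₂ (unpair w₃)

  defect : Oracle → ℕ → ℕ → ℕ → ℕ → ℕ → ℕ → ℕ
  defect Z n e cτ cσ s t =
    ∣ n - pairᵒ (taggedCode e cτ) cσ ∣ + ((suc (pairᵒ cτ cσ) ∸ s) + (remaining Z e 1 (pairᵒ cτ cσ) s +
      (remaining Z r₀ 0 (ev Z enumP (e ∷ s ∷ [])) t + ∣ output Z r₀ 0 (ev Z enumP (e ∷ s ∷ [])) t - 1 ∣)))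

  abstract
    defectP : PR 2
    defectP = addP ⟨ distP ⟨ p0 ∷ pairP ⟨ taggedCodeP ⟨ eP ∷ cτP ∷ [] ⟩ ∷ cσP ∷ [] ⟩ ∷ [] ⟩ ∷
              addP ⟨ subP ⟨ S codeP ∷ sP ∷ [] ⟩ ∷
              addP ⟨ tailsP ⟨ simPcP ⟨ sP ∷ eP ∷ const 1 ∷ codeP ∷ [] ⟩ ∷ eP ∷ [] ⟩ ∷
              addP ⟨ tailsP ⟨ simPcP ⟨ tP ∷ const r₀ ∷ k0 ∷ listP ∷ [] ⟩ ∷ const r₀ ∷ [] ⟩ ∷
                     distP ⟨ lookupP ⟨ k0 ∷ simRegsP ⟨ tP ∷ const r₀ ∷ k0 ∷ listP ∷ [] ⟩ ∷ [] ⟩ ∷ const 1 ∷ [] ⟩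
                     ∷ [] ⟩ ∷ [] ⟩ ∷ [] ⟩ ∷ [] ⟩
      where
      eP w₁ cτP w₂ cσP w₃ sP tP codeP listP : PR 2
      eP    = fstP ⟨ p1 ∷ [] ⟩
      w₁    = sndP ⟨ p1 ∷ [] ⟩
      cτP   = fstP ⟨ w₁ ∷ [] ⟩
      w₂    = sndP ⟨ w₁ ∷ [] ⟩
      cσP   = fstP ⟨ w₂ ∷ [] ⟩
      w₃    = sndP ⟨ w₂ ∷ [] ⟩
      sP    = fstP ⟨ w₃ ∷ [] ⟩
      tP    = sndP ⟨ w₃ ∷ [] ⟩
      codeP = pairP ⟨ cτP ∷ cσP ∷ [] ⟩
      listP = enumP ⟨ eP ∷ sP ∷ [] ⟩

    -- opaque so that the searcher built from it is never unfolded
    checkP : PR 2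
    checkP = ifZ defectP (const 1) k0

    checkP-ev : ∀ Z n w → ev Z checkP (n ∷ w ∷ []) ≡ ifZero (ev Z defectP (n ∷ w ∷ [])) 1 0
    checkP-ev Z n w = ifZeroP-ev Z (ev Z defectP (n ∷ w ∷ [])) 1 0

    defectP-ev : ∀ Z n e cτ cσ s t → ev Z defectP (n ∷ witness e cτ cσ s t ∷ []) ≡ defect Z n e cτ cσ s t
    defectP-ev Z n e cτ cσ s t
      rewrite fstP-ev Z e (pairᵒ cτ (pairᵒ cσ (pairᵒ s t))) | sndP-ev Z e (pairᵒ cτ (pairᵒ cσ (pairᵒ s t)))
            | fstP-ev Z cτ (pairᵒ cσ (pairᵒ s t)) | sndP-ev Z cτ (pairᵒ cσ (pairᵒ s t))
            | fstP-ev Z cσ (pairᵒ s t) | sndP-ev Z cσ (pairᵒ s t)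
            | fstP-ev Z s t | sndP-ev Z s t
            | taggedCodeP-ev Z e cτ | pairP-ev Z (taggedCode e cτ) cσ | distP-ev Z n (pairᵒ (taggedCode e cτ) cσ)
            | pairP-ev Z cτ cσ | subP-ev Z (suc (pairᵒ cτ cσ)) s
            | distP-ev Z (output Z r₀ 0 (ev Z enumP (e ∷ s ∷ [])) t) 1
            | addP-ev Z (remaining Z r₀ 0 (ev Z enumP (e ∷ s ∷ [])) t) ∣ output Z r₀ 0 (ev Z enumP (e ∷ s ∷ [])) t - 1 ∣
            | addP-ev Z (remaining Z e 1 (pairᵒ cτ cσ) s)
                        (remaining Z r₀ 0 (ev Z enumP (e ∷ s ∷ [])) t + ∣ output Z r₀ 0 (ev Z enumP (e ∷ s ∷ [])) t - 1 ∣)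
            | addP-ev Z (suc (pairᵒ cτ cσ) ∸ s)
                        (remaining Z e 1 (pairᵒ cτ cσ) s + (remaining Z r₀ 0 (ev Z enumP (e ∷ s ∷ [])) t
                          + ∣ output Z r₀ 0 (ev Z enumP (e ∷ s ∷ [])) t - 1 ∣))
            | addP-ev Z ∣ n - pairᵒ (taggedCode e cτ) cσ ∣
                        ((suc (pairᵒ cτ cσ) ∸ s) + (remaining Z e 1 (pairᵒ cτ cσ) s + (remaining Z r₀ 0 (ev Z enumP (e ∷ s ∷ [])) t
                          + ∣ output Z r₀ 0 (ev Z enumP (e ∷ s ∷ [])) t - 1 ∣)))
      = refl

  open Search checkP public using (searcher)
  open Search checkP using (searcher-witness; searcher-halts)

  searcher-halts⇒defect≡0 : ∀ Z n → Halts searcher Z n → ∃[ e ] ∃[ cτ ] ∃[ cσ ] ∃[ s ] ∃[ t ] (defect Z n e cτ cσ s t ≡ 0)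
  searcher-halts⇒defect≡0 Z n h with searcher-witness Z n h
  ... | w , v , found with witness-surjective w
  ... | e , cτ , cσ , s , t , refl = e , cτ , cσ , s , t ,
    ifZero-1-0 (defect Z n e cτ cσ s t)
      (trans (sym (cong (λ d → ifZero d 1 0) (defectP-ev Z n e cτ cσ s t)))
             (trans (sym (checkP-ev Z n (witness e cτ cσ s t))) found))
    where
    ifZero-1-0 : ∀ m → ifZero m 1 0 ≡ suc v → m ≡ 0
    ifZero-1-0 zero _ = refl

  defect≡0⇒searcher-halts : ∀ Z n e cτ cσ s t → defect Z n e cτ cσ s t ≡ 0 → Halts searcher Z n
  defect≡0⇒searcher-halts Z n e cτ cσ s t d≡0 = searcher-halts Z n (witness e cτ cσ s t) 0
    (trans (checkP-ev Z n (witness e cτ cσ s t))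
           (cong (λ d → ifZero d 1 0) (trans (defectP-ev Z n e cτ cσ s t) d≡0)))

module Optimal (R : FinSetFamily) (isR : IsRule R) (Z : Oracle) where
  open IsRule isR
  open Execution using (run-deterministic)

  decider : Program
  decider = proj₁ recursive

  open Checker (codeProg decider)

  optimal : Mode
  optimal x = Halts searcher Z (codePair x)

  accepted⇒R : ∀ e s t → let c = ev Z enumP (e ∷ s ∷ []) in
               remaining Z (codeProg decider) 0 c t ≡ 0 → ∣ output Z (codeProg decider) 0 c t - 1 ∣ ≡ 0 →
               R (enumerated Z e s)
  accepted⇒R e s t stopped out≡1
    with proj₂ recursive (enumerated Z e s) | remaining≡0⇒run Z decider 0 (ev Z enumP (e ∷ s ∷ [])) t stopped
  ... | y , (t' , ρ' , r' , ρ'0) , _ , accept | a , ra , a0 = accept (begin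
    y                                                         ≡⟨ sym ρ'0 ⟩
    ρ' 0                                                      ≡⟨ cong (λ ρ → ρ 0) (run-deterministic decider ∅ₒ t' t 0 _ ρ' a r' ra′) ⟩
    a 0                                                       ≡⟨ a0 ⟩
    output Z (codeProg decider) 0 (ev Z enumP (e ∷ s ∷ [])) t  ≡⟨ ∣m-n∣≡0⇒m≡n out≡1 ⟩
    1                                                         ∎)
    where
    open ≡-Reasoning
    ra′ : run decider ∅ₒ t 0 (input (codeList (enumerated Z e s))) ≡ just a
    ra′ = subst (λ q → run decider ∅ₒ t 0 (input q) ≡ just a) (sym (codeList-enumerated Z e s)) ra

  R⇒accepted : ∀ e s → R (enumerated Z e s) → let c = ev Z enumP (e ∷ s ∷ []) in
               ∃[ t ] (remaining Z (codeProg decider) 0 c t ≡ 0 × ∣ output Z (codeProg decider) 0 c t - 1 ∣ ≡ 0)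
  R⇒accepted e s R-A with proj₂ recursive (enumerated Z e s)
  ... | y , (t , ρ , r , ρ0) , accept , _
    with run⇒remaining≡0 Z decider 0 (ev Z enumP (e ∷ s ∷ [])) t ρ
           (subst (λ q → run decider ∅ₒ t 0 (input q) ≡ just ρ) (codeList-enumerated Z e s) r)
  ... | stopped , out = t , stopped , m≡n⇒∣m-n∣≡0 (trans (sym out) (trans ρ0 (accept R-A)))

  Certified : ℕ → Pair → Set
  Certified k x = ∃[ e ] ∃[ τ ] ∃[ s ]
    (replicate k true ++ proj₁ x ≡ tagged e τ × (τ , proj₂ x) ∈ enumerated Z e s × R (enumerated Z e s))

  optimal⇒Certified : ∀ x → optimal x → Certified 0 x
  optimal⇒Certified (τ' , σ) h with searcher-halts⇒defect≡0 Z (codePair (τ' , σ)) h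
  ... | e , cτ , cσ , s , t , d≡0 with +≡0⁵ d≡0
  ... | tagged≡ , below , enumerated≡ , stopped , out≡1
    with pairᵒ-injective {codeStrᵒ τ'} {codeStrᵒ σ} (trans (codePairᵒ≡codePair (τ' , σ)) (∣m-n∣≡0⇒m≡n tagged≡))
  ... | eτ , eσ with codeStrᵒ-taggedCode e cτ τ' eτ
  ... | τ , refl , ecτ = e , τ , s , refl , enumerated-∋ Z e s (τ , σ) code<s halts , accepted⇒R e s t stopped out≡1
    where
    code≡ : pairᵒ cτ cσ ≡ codePairᵒ (τ , σ)
    code≡ = cong₂ pairᵒ (sym ecτ) (sym eσ)
    code<s : codePairᵒ (τ , σ) < s
    code<s = subst (_< s) code≡ (m∸n≡0⇒m≤n below)
    halts : remaining Z e 1 (codePairᵒ (τ , σ)) s ≡ 0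
    halts = subst (λ q → remaining Z e 1 q s ≡ 0) code≡ enumerated≡

  single-stage : ∀ e (q : List Pair) → (∀ {x} → x ∈ q → ∃[ s ] (x ∈ enumerated Z e s × R (enumerated Z e s))) →
                 q ≡ [] ⊎ ∃[ s ] (R (enumerated Z e s) × q ⊆ₗ enumerated Z e s)
  single-stage e [] h = inj₁ refl
  single-stage e (x ∷ q) h with h (here refl) | single-stage e q (λ m → h (there m))
  ... | s₀ , m₀ , R₀ | inj₁ refl = inj₂ (s₀ , R₀ , λ { (here refl) → m₀ ; (there ()) })
  ... | s₀ , m₀ , R₀ | inj₂ (s₁ , R₁ , sub₁) with s₀ ≤? s₁
  ... | yes s₀≤s₁ = inj₂ (s₁ , R₁ , λ { (here refl) → enumerated-mono Z e s₀≤s₁ m₀ ; (there m) → sub₁ m })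
  ... | no s₀≰s₁  = inj₂ (s₀ , R₀ , λ { (here refl) → m₀ ; (there m) → enumerated-mono Z e (≰⇒≥ s₀≰s₁) (sub₁ m) })

  common-stage : ∀ e (q : List Pair) → (∀ {x} → x ∈ q → ∃[ s ] (x ∈ enumerated Z e s × R (enumerated Z e s))) → R q
  common-stage e q h with single-stage e q h
  ... | inj₁ refl = empty
  ... | inj₂ (s , Rs , sub) = downward (enumerated Z e s) q Rs sub

  Certified⇒R : ∀ N k l → (∀ {x} → x ∈ l → Certified k x) → (∀ {x} → x ∈ l → length (proj₁ x) < N) → R l
  Certified⇒R zero    k l cert short = downward [] l empty (λ m → ⊥-elim (n≮0 (short m)))
  Certified⇒R (suc N) k l cert short =
    downward (join (strip false l) (strip true l)) l (joinClosed _ _ R₀ R₁) (⊆-join-strip l (ListAll.tabulate nonempty))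
    where
    R₁ : R (strip true l)
    R₁ = Certified⇒R N (suc k) (strip true l) (λ m → shift (strip-∈⁻ true l m)) (λ m → ≤-pred (short (strip-∈⁻ true l m)))
      where
      shift : ∀ {τ σ} → (true ∷ τ , σ) ∈ l → Certified (suc k) (τ , σ)
      shift {τ} m with cert m
      ... | e , τ' , s , eq , mm , Rs = e , τ' , s , trans (sym (ones-∷ʳ k τ)) eq , mm , Rs
    R₀ : R (strip false l)
    R₀ = common-stage k (strip false l) (λ m → same-machine (strip-∈⁻ false l m))
      where
      same-machine : ∀ {τ σ} → (false ∷ τ , σ) ∈ l → ∃[ s ] ((τ , σ) ∈ enumerated Z k s × R (enumerated Z k s))
      same-machine {τ} m with cert m
      ... | e , τ' , s , eq , mm , Rs with tagged-injective k e τ τ' eq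
      ... | refl , refl = s , mm , Rs
    nonempty : ∀ {x} → x ∈ l → proj₁ x ≢ []
    nonempty {[] , σ} m refl with cert m
    ... | e , τ' , s , eq , _ = ones≢tagged k e τ' eq
    nonempty {_ ∷ _ , σ} m ()

  optimal-IsRMode : IsRMode R optimal
  optimal-IsRMode l all = Certified⇒R (suc (totalLength l)) 0 l (λ {x} m → optimal⇒Certified x (ListAll.lookup all m))
                                      (λ m → s≤s (length≤totalLength l m))

  module _ (M' : Mode) (re : REin Z M') (M'-R : IsRMode R M') where
    P' : Program
    P' = proj₁ re
    e : ℕ
    e = codeProg P'

    enumerated⊆M' : ∀ s {x} → x ∈ enumerated Z e s → M' x
    enumerated⊆M' s m with enumerated-∈ Z e s m
    ... | n , refl , test with remaining≡0⇒run Z P' 1 n s (m+n≡0⇒n≡0 _ test)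
    ... | a , r , _ = proj₂ (proj₂ re (decodePair n)) (s , a , subst (λ q → run P' Z s 0 (input q) ≡ just a) n≡ r)
      where
      n≡ : n ≡ codePair (decodePair n)
      n≡ = trans (sym (validPairP-decode Z n (m+n≡0⇒m≡0 _ test))) (codePairᵒ≡codePair (decodePair n))

    tagged-optimal : ∀ τ σ → M' (τ , σ) → optimal (tagged e τ , σ)
    tagged-optimal τ σ m' with proj₁ (proj₂ re (τ , σ)) m'
    ... | f , ρ , r = defect≡0⇒searcher-halts Z (codePair (tagged e τ , σ)) e (codeStrᵒ τ) (codeStrᵒ σ) s t d≡0
      where
      y s : ℕ
      y = codePairᵒ (τ , σ)
      s = f + suc y
      rs : run P' Z s 0 (input y) ≡ just ρ
      rs = Execution.run-mono P' Z f 0 (input y) ρ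
             (subst (λ q → run P' Z f 0 (input q) ≡ just ρ) (sym (codePairᵒ≡codePair (τ , σ))) r) (suc y)
      accepted : ∃[ t ] (remaining Z (codeProg decider) 0 (ev Z enumP (e ∷ s ∷ [])) t ≡ 0 ×
                         ∣ output Z (codeProg decider) 0 (ev Z enumP (e ∷ s ∷ [])) t - 1 ∣ ≡ 0)
      accepted = R⇒accepted e s (M'-R (enumerated Z e s) (ListAll.tabulate (enumerated⊆M' s)))
      t : ℕ
      t = proj₁ accepted
      tagged≡ : ∣ codePair (tagged e τ , σ) - pairᵒ (taggedCode e (codeStrᵒ τ)) (codeStrᵒ σ) ∣ ≡ 0
      tagged≡ = m≡n⇒∣m-n∣≡0 (trans (sym (codePairᵒ≡codePair (tagged e τ , σ)))
                                   (cong (λ q → pairᵒ q (codeStrᵒ σ)) (sym (taggedCode-codeStrᵒ e τ))))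
      d≡0 : defect Z (codePair (tagged e τ , σ)) e (codeStrᵒ τ) (codeStrᵒ σ) s t ≡ 0
      d≡0 rewrite tagged≡ | m≤n⇒m∸n≡0 (m≤n+m (suc y) f) | proj₁ (run⇒remaining≡0 Z P' 1 y s ρ rs)
                | proj₁ (proj₂ accepted) | proj₂ (proj₂ accepted) = refl

    optimal-dominates : Dominates optimal M' (suc e)
    optimal-dominates σ n (τ , m' , |τ|≤n) = tagged e τ , tagged-optimal τ σ m' , (begin
      length (tagged e τ)  ≡⟨ length-tagged e τ ⟩
      e + suc (length τ)   ≤⟨ +-monoʳ-≤ e (s≤s |τ|≤n) ⟩
      e + suc n            ≡⟨ +-suc e n ⟩
      suc e + n            ≡⟨ +-comm (suc e) n ⟩
      n + suc e            ∎)
      where open ≤-Reasoning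

  optimal-IsROptimal : IsROptimal R Z optimal
  optimal-IsROptimal = (searcher , λ x → (λ h → h) , (λ h → h)) , optimal-IsRMode ,
                       λ M' re M'-R → suc (codeProg (proj₁ re)) , optimal-dominates M' re M'-R

mainTheorem4 : (R : FinSetFamily) → IsRule R → (Z : Oracle) → Σ Mode (λ M → IsROptimal R Z M)
mainTheorem4 R isR Z = Optimal.optimal R isR Z , Optimal.optimal-IsROptimal R isR Z
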